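{- Let $q$ be a prime power, $l\ge1$, and let $1\le t_1\le t_2\le\dots\le t_{l+1}$ be integers with $k=\sum_{i=1}^{l+1}t_i$. The number of elements of the set $$S=\{(f_1,\dots,f_{l+1})\mid f_i\in\mathbb{F}_q[X],\ \deg(f_i)\le t_i-1,\ (f_1,\dots,f_{l+1})\text{ is in reduced form}\}$$ is $q^{k-1}+q^{k-2}+\dots+q^{k-l}+1$.
   Context: A tuple of polynomials $(f_1,\dots,f_{l+1})$ over $\mathbb{F}_q$ is in reduced form if its first non-zero polynomial is monic and $\gcd(f_1,\dots,f_{l+1})=1$ (gcd taken monic). Zero polynomials are allowed. -}

module Defs where

open import Level using (0ℓ)
open import Data.Nat using (ℕ; zero; suc; _^_; _∸_; _+_)
open import Data.Fin using (Fin)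
open import Data.List using (List; []; _∷_; _++_; [_]; map; upTo)
open import Data.Nat.ListAction using (sum)
open import Data.List.Relation.Unary.All using (All)
open import Data.Vec using (Vec; toList)
import Data.Vec as Vec
open import Data.Product using (Σ; ∃; _×_; _,_)
open import Data.Sum using (_⊎_)
open import Data.Empty using (⊥)
open import Data.Unit using (⊤)
open import Relation.Nullary using (¬_)
open import Relation.Binary.PropositionalEquality using (_≡_)
open import Algebra.Structures using (IsCommutativeRing)
open import Function.Bundles using (_↔_)

-- A finite field with exactly q elements (q is then necessarily a prime
-- power; every prime power arises).  Equality is propositional equality.
record FiniteField (q : ℕ) : Set₁ where
  field
    F    : Set
    _+F_ : F → F → F
    _*F_ : F → F → F
    -F_  : F → F
    0F   : F
    1F   : F
    isCommutativeRing : IsCommutativeRing _≡_ _+F_ _*F_ -F_ 0F 1F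
    0≢1  : ¬ (0F ≡ 1F)
    inverse : ∀ x → ¬ (x ≡ 0F) → ∃ λ y → (x *F y) ≡ 1F
    enumeration : F ↔ Fin q

module Poly {q : ℕ} (𝔽 : FiniteField q) where
  open FiniteField 𝔽

  -- polynomials as coefficient lists, lowest degree first
  -- (trailing zeros allowed; equality is taken up to trailing zeros)
  Pol : Set
  Pol = List F

  _+ₚ_ : Pol → Pol → Pol
  [] +ₚ g = g
  (a ∷ f) +ₚ [] = a ∷ f
  (a ∷ f) +ₚ (b ∷ g) = (a +F b) ∷ (f +ₚ g)

  negₚ : Pol → Pol
  negₚ = map -F_

  _*ₚ_ : Pol → Pol → Pol
  [] *ₚ g = []
  (a ∷ f) *ₚ g = map (a *F_) g +ₚ (0F ∷ (f *ₚ g))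

  IsZero : Pol → Set
  IsZero p = All (_≡ 0F) p

  _≈ₚ_ : Pol → Pol → Set
  f ≈ₚ g = IsZero (f +ₚ negₚ g)

  _∣ₚ_ : Pol → Pol → Set
  g ∣ₚ f = Σ Pol λ h → (g *ₚ h) ≈ₚ f

  Monic : Pol → Set
  Monic p = Σ Pol λ as → Σ Pol λ bs → (p ≡ as ++ (1F ∷ bs)) × IsZero bs

  -- tuples (f_1,…,f_n) with deg f_i ≤ t_i − 1, i.e. t_i coefficients
  Tuple : {n : ℕ} → Vec ℕ n → Set
  Tuple Vec.[] = ⊤
  Tuple (t Vec.∷ ts) = Vec F t × Tuple ts

  FirstNonzeroMonic : {n : ℕ} (ts : Vec ℕ n) → Tuple ts → Set
  FirstNonzeroMonic Vec.[] _ = ⊥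
  FirstNonzeroMonic (t Vec.∷ ts) (f , fs) =
    (IsZero (toList f) × FirstNonzeroMonic ts fs) ⊎ Monic (toList f)

  DividesAll : (g : Pol) {n : ℕ} (ts : Vec ℕ n) → Tuple ts → Set
  DividesAll g Vec.[] _ = ⊤
  DividesAll g (t Vec.∷ ts) (f , fs) = (g ∣ₚ toList f) × DividesAll g ts fs

  GcdOne : {n : ℕ} (ts : Vec ℕ n) → Tuple ts → Set
  GcdOne ts fs = ∀ g → DividesAll g ts fs → g ∣ₚ [ 1F ]

  ReducedForm : {n : ℕ} (ts : Vec ℕ n) → Tuple ts → Set
  ReducedForm ts fs = FirstNonzeroMonic ts fs × GcdOne ts fs


expectedCount : (q l k : ℕ) → ℕ
expectedCount q l k = sum (map (λ j → q ^ (k ∸ suc j)) (upTo l)) + 1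

module Submission where

-- Let K = t₁ + ⋯ + tₙ, so that there are q^K tuples (f₁,…,fₙ) with deg fᵢ < tᵢ.  A nonzero such
-- tuple is uniquely g·(h₁,…,hₙ) with g ≠ 0 of some degree e and (hᵢ) in reduced form with
-- deg hᵢ < tᵢ − e: g is the gcd of the fᵢ, rescaled so that the first nonzero hᵢ is monic.
-- Writing R(t) for the number of reduced tuples, this gives
--     q^K = 1 + Σₑ qᵉ (q − 1) R(t − e).
-- As every tᵢ ≥ 1, the same identity for t − 1 = (tᵢ − 1)ᵢ is the part e ≥ 1 of the sum for t,
-- divided by q.  Hence q^K = 1 + (q − 1) R(t) + q (q^(K−n) − 1), which solves to
-- R(t) = q^(K−1) + ⋯ + q^(K−l) + 1 for n = l + 1.

open import Defs
open import Data.Nat using (ℕ; zero; suc; _+_; _*_; _^_; _∸_; _≤_; _<_; z≤n; s≤s; NonZero; >-nonZero)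
import Data.Nat.Properties as ℕ
import Data.Nat.ListAction as ListAction
open import Data.Product using (Σ; ∃; _×_; _,_; proj₁; proj₂)
open import Data.List using (List; []; _∷_; map; _++_; length; upTo; filter; allFin)
open import Data.List.Properties using (length-++; length-map; map-applyUpTo; map-cong; length-tabulate)
open import Data.List.Relation.Unary.All using ([]; _∷_)
import Data.List.Relation.Unary.All as All
open import Data.List.Relation.Unary.All.Properties using (All¬⇒¬Any)
open import Data.List.Relation.Unary.Any using (here; there)
open import Data.List.Relation.Unary.AllPairs using ([]; _∷_)
open import Data.List.Membership.Propositional using (_∈_)
open import Data.List.Membership.Propositional.Properties using (∈-map⁺; ∈-map⁻; ∈-++⁺ˡ; ∈-++⁺ʳ; ∈-++⁻; ∈-filter⁺; ∈-filter⁻; ∈-allFin; ∈-upTo⁺; ∈-upTo⁻; ∈-length)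
open import Data.List.Membership.Propositional.Properties.WithK using (unique∧set⇒bag)
open import Data.List.Relation.Unary.Unique.Propositional using (Unique)
import Data.List.Relation.Unary.Unique.Propositional.Properties as Unique
open import Data.List.Relation.Binary.BagAndSetEquality using (∼bag⇒↭)
open import Data.List.Relation.Binary.Permutation.Propositional.Properties using (↭-length)
open import Data.List.Relation.Binary.Pointwise as Pointwise using (Pointwise; []; _∷_)
open import Data.Vec using (Vec; toList) renaming ([] to []ᵥ; _∷_ to _∷ᵥ_)
import Data.Vec as Vec
open import Data.Vec.Relation.Unary.All using ([]; _∷_) renaming (All to Allᵥ)
open import Data.Sum using (_⊎_; inj₁; inj₂)
open import Data.Empty using (⊥; ⊥-elim)
open import Data.Unit using (tt)
open import Function using (_∘_)
open import Function.Bundles using (Inverse; _⇔_; mk⇔)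
open import Relation.Nullary using (¬_; ¬?; Dec; yes; no; _×-dec_)
open import Relation.Binary.PropositionalEquality
open import Relation.Binary using (DecidableEquality)
open import Relation.Nullary.Decidable using (via-injection)
open import Function.Properties.Inverse using (↔⇒↣)
import Data.Fin as Fin
open import Algebra.Structures using (IsCommutativeRing)
open import Algebra.Bundles using (CommutativeRing; CommutativeSemiring)
import Algebra.Properties.Group as GroupProperties
import Algebra.Properties.AbelianGroup as AbelianGroupProperties
import Algebra.Properties.Ring as RingProperties
import Relation.Binary.Reasoning.Setoid as SetoidReasoning
import Algebra.Solver.Ring.NaturalCoefficients.Default as NaturalCoefficients

module Enumeration where
  open All using (All)
  open ListAction using (sum)

  length-unique : ∀ {A : Set} {xs ys : List A} → Unique xs → Unique ys →
    (∀ {x} → x ∈ xs → x ∈ ys) → (∀ {x} → x ∈ ys → x ∈ xs) → length xs ≡ length ys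
  length-unique uxs uys xs⊆ys ys⊆xs = ↭-length (∼bag⇒↭ (unique∧set⇒bag uxs uys (mk⇔ xs⊆ys ys⊆xs)))

  sum-map-const : ∀ {A : Set} (xs : List A) c → sum (map (λ _ → c) xs) ≡ length xs * c
  sum-map-const [] c = refl
  sum-map-const (x ∷ xs) c = cong (c +_) (sum-map-const xs c)

  Unique-map⁺ : ∀ {A B : Set} (f : A → B) {xs : List A} →
    (∀ {x y} → x ∈ xs → y ∈ xs → f x ≡ f y → x ≡ y) → Unique xs → Unique (map f xs)
  Unique-map⁺ f {[]} inj [] = []
  Unique-map⁺ f {x ∷ xs} inj (x∉xs ∷ u) =
    distinct xs (λ m → m) x∉xs ∷ Unique-map⁺ f (λ mx my → inj (there mx) (there my)) u
    where
    distinct : ∀ ys → (∀ {y} → y ∈ ys → y ∈ xs) →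
      All (λ y → ¬ (x ≡ y)) ys → All (λ y → ¬ (f x ≡ y)) (map f ys)
    distinct [] _ [] = []
    distinct (y ∷ ys) ys⊆xs (x≢y ∷ x∉ys) =
      (λ e → x≢y (inj (here refl) (there (ys⊆xs (here refl))) e)) ∷ distinct ys (ys⊆xs ∘ there) x∉ys

  dependentProduct : ∀ {A : Set} {B : A → Set} → List A → ((a : A) → List (B a)) → List (Σ A B)
  dependentProduct [] f = []
  dependentProduct (a ∷ xs) f = map (a ,_) (f a) ++ dependentProduct xs f

  module _ {A : Set} {B : A → Set} where

    length-dependentProduct : (xs : List A) (f : (a : A) → List (B a)) →
      length (dependentProduct xs f) ≡ sum (map (λ a → length (f a)) xs)
    length-dependentProduct [] f = refl
    length-dependentProduct (a ∷ xs) f =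
      trans (length-++ (map (a ,_) (f a)) {dependentProduct xs f})
            (cong₂ _+_ (length-map {B = Σ A B} (a ,_) (f a)) (length-dependentProduct xs f))

    ∈-dependentProduct⁺ : ∀ {xs : List A} {f : (a : A) → List (B a)} {a b} →
      a ∈ xs → b ∈ f a → (a , b) ∈ dependentProduct xs f
    ∈-dependentProduct⁺ {a ∷ xs} (here refl) b∈fa = ∈-++⁺ˡ (∈-map⁺ (a ,_) b∈fa)
    ∈-dependentProduct⁺ {x ∷ xs} {f} (there a∈xs) b∈fa =
      ∈-++⁺ʳ (map (x ,_) (f x)) (∈-dependentProduct⁺ a∈xs b∈fa)

    ∈-dependentProduct⁻ : ∀ {xs : List A} {f : (a : A) → List (B a)} {a b} →
      (a , b) ∈ dependentProduct xs f → a ∈ xs × b ∈ f a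
    ∈-dependentProduct⁻ {x ∷ xs} {f} m with ∈-++⁻ (map (x ,_) (f x)) m
    ... | inj₁ m₁ with ∈-map⁻ (x ,_) m₁
    ...   | _ , b∈fx , refl = here refl , b∈fx
    ∈-dependentProduct⁻ {x ∷ xs} m | inj₂ m₂ with ∈-dependentProduct⁻ {xs} m₂
    ...   | a∈xs , b∈fa = there a∈xs , b∈fa

    Unique-dependentProduct⁺ : ∀ {xs : List A} {f : (a : A) → List (B a)} →
      Unique xs → (∀ a → Unique (f a)) → Unique (dependentProduct xs f)
    Unique-dependentProduct⁺ {[]} [] uf = []
    Unique-dependentProduct⁺ {a ∷ xs} {f} (a∉xs ∷ uxs) uf =
      Unique.++⁺ (Unique.map⁺ (λ { refl → refl }) (uf a)) (Unique-dependentProduct⁺ uxs uf) disjoint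
      where
      disjoint : ∀ {v} → ¬ (v ∈ map (a ,_) (f a) × v ∈ dependentProduct xs f)
      disjoint (m₁ , m₂) with ∈-map⁻ (a ,_) m₁
      ... | _ , _ , refl = All¬⇒¬Any a∉xs (proj₁ (∈-dependentProduct⁻ {xs} m₂))

module GeometricSum where
  open ListAction using (sum)
  open ≡-Reasoning

  sum-upTo-suc : ∀ (f : ℕ → ℕ) n → sum (map f (upTo (suc n))) ≡ f 0 + sum (map (f ∘ suc) (upTo n))
  sum-upTo-suc f n =
    cong (λ xs → f 0 + sum xs) (trans (map-applyUpTo suc f n) (sym (map-applyUpTo (λ i → i) (f ∘ suc) n)))

  sum-map-*ˡ : ∀ c (f : ℕ → ℕ) xs → sum (map (λ i → c * f i) xs) ≡ c * sum (map f xs)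
  sum-map-*ˡ c f [] = sym (ℕ.*-zeroʳ c)
  sum-map-*ˡ c f (x ∷ xs) =
    trans (cong (c * f x +_) (sum-map-*ˡ c f xs)) (sym (ℕ.*-distribˡ-+ c (f x) _))

  geometric : ∀ d l K → l ≤ K →
    d * sum (map (λ j → suc d ^ (K ∸ suc j)) (upTo l)) + suc d ^ (K ∸ l) ≡ suc d ^ K
  geometric d zero K _ = cong (_+ suc d ^ K) (ℕ.*-zeroʳ d)
  geometric d (suc l) (suc K) (s≤s l≤K) = begin
    d * sum (map (λ j → suc d ^ (suc K ∸ suc j)) (upTo (suc l))) + suc d ^ (K ∸ l)
        ≡⟨ cong (λ x → d * x + suc d ^ (K ∸ l)) (sum-upTo-suc (λ j → suc d ^ (suc K ∸ suc j)) l) ⟩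
    d * (suc d ^ K + A) + suc d ^ (K ∸ l)    ≡⟨ cong (_+ suc d ^ (K ∸ l)) (ℕ.*-distribˡ-+ d (suc d ^ K) A) ⟩
    d * suc d ^ K + d * A + suc d ^ (K ∸ l)  ≡⟨ ℕ.+-assoc (d * suc d ^ K) (d * A) _ ⟩
    d * suc d ^ K + (d * A + suc d ^ (K ∸ l)) ≡⟨ cong (d * suc d ^ K +_) (geometric d l K l≤K) ⟩
    d * suc d ^ K + suc d ^ K                ≡⟨ ℕ.+-comm (d * suc d ^ K) _ ⟩
    suc d ^ suc K                            ∎
    where A = sum (map (λ j → suc d ^ (K ∸ suc j)) (upTo l))

  -- big and small are the counts of tuples for t and for t − 1 from the header, with d = q − 1.
  expectedCount-from-recurrence : ∀ {Q} d l K r a → .{{NonZero d}} → Q ≡ suc d →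
    Q ^ (K + suc l) ≡ suc (d * r + Q * a) → Q ^ K ≡ suc a → expectedCount Q l (K + suc l) ≡ r
  expectedCount-from-recurrence d l K r a refl big small = ℕ.*-cancelˡ-≡ (E + 1) r d dE+d≡dr
    where
    Q = suc d
    N = K + suc l
    E = sum (map (λ j → Q ^ (N ∸ suc j)) (upTo l))
    N∸l≡1+K : N ∸ l ≡ suc K
    N∸l≡1+K = trans (cong (_∸ l) (ℕ.+-suc K l)) (ℕ.m+n∸n≡m (suc K) l)
    dE+Q+Qa : d * E + Q + Q * a ≡ suc (d * r) + Q * a
    dE+Q+Qa = begin
      d * E + Q + Q * a      ≡⟨ ℕ.+-assoc (d * E) Q (Q * a) ⟩
      d * E + (Q + Q * a)    ≡⟨ cong (d * E +_) (sym (ℕ.*-suc Q a)) ⟩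
      d * E + Q * suc a      ≡⟨ cong (λ x → d * E + Q * x) (sym small) ⟩
      d * E + Q ^ suc K      ≡⟨ cong (λ n → d * E + Q ^ n) (sym N∸l≡1+K) ⟩
      d * E + Q ^ (N ∸ l)    ≡⟨ geometric d l N (ℕ.≤-trans (ℕ.n≤1+n l) (ℕ.m≤n+m (suc l) K)) ⟩
      Q ^ N                  ≡⟨ big ⟩
      suc (d * r) + Q * a    ∎
    dE+d≡dr : d * (E + 1) ≡ d * r
    dE+d≡dr = begin
      d * (E + 1)      ≡⟨ ℕ.*-distribˡ-+ d E 1 ⟩
      d * E + d * 1    ≡⟨ cong (d * E +_) (ℕ.*-identityʳ d) ⟩
      d * E + d        ≡⟨ ℕ.suc-injective (trans (sym (ℕ.+-suc (d * E) d)) (ℕ.+-cancelʳ-≡ (Q * a) _ _ dE+Q+Qa)) ⟩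
      d * r            ∎

module Polynomials {q : ℕ} (𝔽 : FiniteField q) where
  open FiniteField 𝔽 renaming (_+F_ to infixl 6 _+F_; _*F_ to infixl 7 _*F_)
  open Poly 𝔽 renaming (_+ₚ_ to infixl 6 _+ₚ_; _*ₚ_ to infixl 7 _*ₚ_)
  open All using (All)
  open ListAction using (sum)
  open Enumeration
  open GeometricSum
  private module F = IsCommutativeRing isCommutativeRing

  _≟F_ : DecidableEquality F
  _≟F_ = via-injection (↔⇒↣ enumeration) Fin._≟_

  fieldSemiring : CommutativeSemiring _ _
  fieldSemiring = record { isCommutativeSemiring = F.isCommutativeSemiring }

  module FieldSolver = NaturalCoefficients fieldSemiring

  -F0≡0 : -F 0F ≡ 0F
  -F0≡0 = trans (sym (F.+-identityˡ (-F 0F))) (F.-‿inverseʳ 0F)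

  inv : (a : F) → ¬ (a ≡ 0F) → F
  inv a a≢0 = proj₁ (inverse a a≢0)

  *-inverseʳ : (a : F) (a≢0 : ¬ (a ≡ 0F)) → a *F inv a a≢0 ≡ 1F
  *-inverseʳ a a≢0 = proj₂ (inverse a a≢0)

  *-inverseˡ : (a : F) (a≢0 : ¬ (a ≡ 0F)) → inv a a≢0 *F a ≡ 1F
  *-inverseˡ a a≢0 = trans (F.*-comm _ _) (*-inverseʳ a a≢0)

  1≢0 : ¬ (1F ≡ 0F)
  1≢0 = 0≢1 ∘ sym

  *-nonzero : ∀ {a b} → ¬ (a ≡ 0F) → ¬ (b ≡ 0F) → ¬ (a *F b ≡ 0F)
  *-nonzero {a} {b} a≢0 b≢0 ab≡0 = b≢0 (begin
    b                         ≡⟨ sym (F.*-identityˡ b) ⟩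
    1F *F b                   ≡⟨ cong (_*F b) (sym (*-inverseˡ a a≢0)) ⟩
    inv a a≢0 *F a *F b       ≡⟨ F.*-assoc _ _ _ ⟩
    inv a a≢0 *F (a *F b)     ≡⟨ cong (inv a a≢0 *F_) ab≡0 ⟩
    inv a a≢0 *F 0F           ≡⟨ F.zeroʳ _ ⟩
    0F                        ∎)
    where open ≡-Reasoning

  inv-nonzero : (a : F) (a≢0 : ¬ (a ≡ 0F)) → ¬ (inv a a≢0 ≡ 0F)
  inv-nonzero a a≢0 e = 1≢0 (trans (sym (*-inverseʳ a a≢0)) (trans (cong (a *F_) e) (F.zeroʳ a)))

  -- Polynomials are compared by the extensional relation _≋_ on coefficient sequences;
  -- _≈ₚ_ of Defs is shown equivalent to it once subtraction is available.
  coeff : Pol → ℕ → F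
  coeff [] n = 0F
  coeff (a ∷ f) zero = a
  coeff (a ∷ f) (suc n) = coeff f n

  infix 4 _≋_
  record _≋_ (f g : Pol) : Set where
    constructor mk≋
    field coeff-≡ : ∀ n → coeff f n ≡ coeff g n
  open _≋_ public

  ≋-refl : ∀ {f} → f ≋ f
  ≋-refl = mk≋ λ n → refl

  ≋-sym : ∀ {f g} → f ≋ g → g ≋ f
  ≋-sym e = mk≋ λ n → sym (coeff-≡ e n)

  ≋-trans : ∀ {f g h} → f ≋ g → g ≋ h → f ≋ h
  ≋-trans e e′ = mk≋ λ n → trans (coeff-≡ e n) (coeff-≡ e′ n)

  ∷-cong : ∀ {a b f g} → a ≡ b → f ≋ g → a ∷ f ≋ b ∷ g
  ∷-cong a≡b e = mk≋ λ { zero → a≡b ; (suc n) → coeff-≡ e n }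

  ≋-head : ∀ {a b f g} → a ∷ f ≋ b ∷ g → a ≡ b
  ≋-head e = coeff-≡ e zero

  ≋-tail : ∀ {a b f g} → a ∷ f ≋ b ∷ g → f ≋ g
  ≋-tail e = mk≋ λ n → coeff-≡ e (suc n)

  scale : F → Pol → Pol
  scale a = map (a *F_)

  coeff-+ₚ : ∀ f g n → coeff (f +ₚ g) n ≡ coeff f n +F coeff g n
  coeff-+ₚ [] g n = sym (F.+-identityˡ _)
  coeff-+ₚ (a ∷ f) [] n = sym (F.+-identityʳ _)
  coeff-+ₚ (a ∷ f) (b ∷ g) zero = refl
  coeff-+ₚ (a ∷ f) (b ∷ g) (suc n) = coeff-+ₚ f g n

  coeff-negₚ : ∀ f n → coeff (negₚ f) n ≡ -F coeff f n
  coeff-negₚ [] n = sym -F0≡0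
  coeff-negₚ (a ∷ f) zero = refl
  coeff-negₚ (a ∷ f) (suc n) = coeff-negₚ f n

  coeff-scale : ∀ a f n → coeff (scale a f) n ≡ a *F coeff f n
  coeff-scale a [] n = sym (F.zeroʳ a)
  coeff-scale a (b ∷ f) zero = refl
  coeff-scale a (b ∷ f) (suc n) = coeff-scale a f n

  coeff-∷*ₚ : ∀ a f g n → coeff ((a ∷ f) *ₚ g) n ≡ a *F coeff g n +F coeff (0F ∷ f *ₚ g) n
  coeff-∷*ₚ a f g n = trans (coeff-+ₚ (scale a g) (0F ∷ f *ₚ g) n) (cong (_+F _) (coeff-scale a g n))

  +ₚ-cong : ∀ {f f′ g g′} → f ≋ f′ → g ≋ g′ → f +ₚ g ≋ f′ +ₚ g′
  +ₚ-cong {f} {f′} {g} {g′} e e′ = mk≋ λ n →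
    trans (coeff-+ₚ f g n) (trans (cong₂ _+F_ (coeff-≡ e n) (coeff-≡ e′ n)) (sym (coeff-+ₚ f′ g′ n)))

  negₚ-cong : ∀ {f f′} → f ≋ f′ → negₚ f ≋ negₚ f′
  negₚ-cong {f} {f′} e = mk≋ λ n →
    trans (coeff-negₚ f n) (trans (cong -F_ (coeff-≡ e n)) (sym (coeff-negₚ f′ n)))

  scale-cong : ∀ {a b f f′} → a ≡ b → f ≋ f′ → scale a f ≋ scale b f′
  scale-cong {a} {b} {f} {f′} a≡b e = mk≋ λ n →
    trans (coeff-scale a f n) (trans (cong₂ _*F_ a≡b (coeff-≡ e n)) (sym (coeff-scale b f′ n)))

  +ₚ-comm : ∀ f g → f +ₚ g ≋ g +ₚ f
  +ₚ-comm f g = mk≋ λ n → trans (coeff-+ₚ f g n) (trans (F.+-comm _ _) (sym (coeff-+ₚ g f n)))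

  +ₚ-assoc : ∀ f g h → (f +ₚ g) +ₚ h ≋ f +ₚ (g +ₚ h)
  +ₚ-assoc f g h = mk≋ λ n → begin
    coeff ((f +ₚ g) +ₚ h) n                   ≡⟨ coeff-+ₚ (f +ₚ g) h n ⟩
    coeff (f +ₚ g) n +F coeff h n             ≡⟨ cong (_+F coeff h n) (coeff-+ₚ f g n) ⟩
    coeff f n +F coeff g n +F coeff h n       ≡⟨ F.+-assoc _ _ _ ⟩
    coeff f n +F (coeff g n +F coeff h n)     ≡⟨ cong (coeff f n +F_) (sym (coeff-+ₚ g h n)) ⟩
    coeff f n +F coeff (g +ₚ h) n             ≡⟨ sym (coeff-+ₚ f (g +ₚ h) n) ⟩
    coeff (f +ₚ (g +ₚ h)) n                   ∎
    where open ≡-Reasoning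

  +ₚ-identityʳ : ∀ f → f +ₚ [] ≋ f
  +ₚ-identityʳ [] = ≋-refl
  +ₚ-identityʳ (a ∷ f) = ≋-refl

  +ₚ-inverseʳ : ∀ f → f +ₚ negₚ f ≋ []
  +ₚ-inverseʳ f = mk≋ λ n →
    trans (coeff-+ₚ f (negₚ f) n) (trans (cong (coeff f n +F_) (coeff-negₚ f n)) (F.-‿inverseʳ _))

  +ₚ-inverseˡ : ∀ f → negₚ f +ₚ f ≋ []
  +ₚ-inverseˡ f = ≋-trans (+ₚ-comm (negₚ f) f) (+ₚ-inverseʳ f)

  *ₚ-zeroˡ : ∀ {f} g → f ≋ [] → f *ₚ g ≋ []
  *ₚ-zeroˡ {[]} g e = ≋-refl
  *ₚ-zeroˡ {a ∷ f} g e = mk≋ λ n →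
    trans (coeff-∷*ₚ a f g n) (trans (cong₂ _+F_ (a·g≡0 n) (shifted n)) (F.+-identityˡ 0F))
    where
    shifted : ∀ n → coeff (0F ∷ f *ₚ g) n ≡ 0F
    shifted zero = refl
    shifted (suc n) = coeff-≡ (*ₚ-zeroˡ {f} g (mk≋ λ m → coeff-≡ e (suc m))) n
    a·g≡0 : ∀ n → a *F coeff g n ≡ 0F
    a·g≡0 n = trans (cong (_*F coeff g n) (coeff-≡ e zero)) (F.zeroˡ _)

  *ₚ-congˡ : ∀ {f f′} g → f ≋ f′ → f *ₚ g ≋ f′ *ₚ g
  *ₚ-congˡ {[]} {f′} g e = ≋-sym (*ₚ-zeroˡ g (≋-sym e))
  *ₚ-congˡ {a ∷ f} {[]} g e = *ₚ-zeroˡ g e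
  *ₚ-congˡ {a ∷ f} {b ∷ f′} g e =
    +ₚ-cong (scale-cong (≋-head e) ≋-refl) (∷-cong refl (*ₚ-congˡ g (≋-tail e)))

  *ₚ-zeroʳ : ∀ f → f *ₚ [] ≋ []
  *ₚ-zeroʳ [] = ≋-refl
  *ₚ-zeroʳ (a ∷ f) = mk≋ λ { zero → refl ; (suc n) → coeff-≡ (*ₚ-zeroʳ f) n }

  *ₚ-∷ʳ : ∀ f b g → f *ₚ (b ∷ g) ≋ scale b f +ₚ (0F ∷ f *ₚ g)
  *ₚ-∷ʳ [] b g = mk≋ λ { zero → refl ; (suc n) → refl }
  *ₚ-∷ʳ (a ∷ f) b g = mk≋ λ where
      zero → cong (_+F 0F) (F.*-comm a b)
      (suc n) → begin
        coeff (scale a g +ₚ f *ₚ (b ∷ g)) n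
          ≡⟨ coeff-+ₚ (scale a g) (f *ₚ (b ∷ g)) n ⟩
        coeff (scale a g) n +F coeff (f *ₚ (b ∷ g)) n
          ≡⟨ cong (coeff (scale a g) n +F_) (trans (coeff-≡ (*ₚ-∷ʳ f b g) n) (coeff-+ₚ (scale b f) _ n)) ⟩
        coeff (scale a g) n +F (coeff (scale b f) n +F coeff (0F ∷ f *ₚ g) n)
          ≡⟨ exchange _ _ _ ⟩
        coeff (scale b f) n +F (coeff (scale a g) n +F coeff (0F ∷ f *ₚ g) n)
          ≡⟨ cong (coeff (scale b f) n +F_) (sym (coeff-+ₚ (scale a g) _ n)) ⟩
        coeff (scale b f) n +F coeff (scale a g +ₚ (0F ∷ f *ₚ g)) n
          ≡⟨ sym (coeff-+ₚ (scale b f) _ n) ⟩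
        coeff (scale b f +ₚ (scale a g +ₚ (0F ∷ f *ₚ g))) n ∎
    where
    open ≡-Reasoning
    open FieldSolver
    exchange : ∀ x y z → x +F (y +F z) ≡ y +F (x +F z)
    exchange = solve 3 (λ x y z → x :+ (y :+ z) := y :+ (x :+ z)) refl

  *ₚ-comm : ∀ f g → f *ₚ g ≋ g *ₚ f
  *ₚ-comm [] g = ≋-sym (*ₚ-zeroʳ g)
  *ₚ-comm (a ∷ f) g = ≋-trans (+ₚ-cong ≋-refl (∷-cong refl (*ₚ-comm f g))) (≋-sym (*ₚ-∷ʳ g a f))

  *ₚ-congʳ : ∀ f {g g′} → g ≋ g′ → f *ₚ g ≋ f *ₚ g′
  *ₚ-congʳ f {g} {g′} e = ≋-trans (*ₚ-comm f g) (≋-trans (*ₚ-congˡ f e) (*ₚ-comm g′ f))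

  *ₚ-cong : ∀ {f f′ g g′} → f ≋ f′ → g ≋ g′ → f *ₚ g ≋ f′ *ₚ g′
  *ₚ-cong {f} {f′} {g} e e′ = ≋-trans (*ₚ-congˡ g e) (*ₚ-congʳ f′ e′)

  scale-*ₚ : ∀ a f g → scale a f *ₚ g ≋ scale a (f *ₚ g)
  scale-*ₚ a [] g = ≋-refl
  scale-*ₚ a (b ∷ f) g = mk≋ λ n → begin
    coeff ((a *F b ∷ scale a f) *ₚ g) n
      ≡⟨ coeff-∷*ₚ (a *F b) (scale a f) g n ⟩
    a *F b *F coeff g n +F coeff (0F ∷ scale a f *ₚ g) n
      ≡⟨ cong (a *F b *F coeff g n +F_) (shifted n) ⟩
    a *F b *F coeff g n +F a *F coeff (0F ∷ f *ₚ g) n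
      ≡⟨ factor _ _ _ _ ⟩
    a *F (b *F coeff g n +F coeff (0F ∷ f *ₚ g) n)
      ≡⟨ cong (a *F_) (sym (coeff-∷*ₚ b f g n)) ⟩
    a *F coeff ((b ∷ f) *ₚ g) n
      ≡⟨ sym (coeff-scale a ((b ∷ f) *ₚ g) n) ⟩
    coeff (scale a ((b ∷ f) *ₚ g)) n ∎
    where
    open ≡-Reasoning
    open FieldSolver
    factor : ∀ a b x y → a *F b *F x +F a *F y ≡ a *F (b *F x +F y)
    factor = solve 4 (λ a b x y → (a :* b) :* x :+ a :* y := a :* (b :* x :+ y)) refl
    shifted : ∀ n → coeff (0F ∷ scale a f *ₚ g) n ≡ a *F coeff (0F ∷ f *ₚ g) n
    shifted zero = sym (F.zeroʳ a)
    shifted (suc n) = trans (coeff-≡ (scale-*ₚ a f g) n) (coeff-scale a (f *ₚ g) n)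

  *ₚ-distribʳ : ∀ f f′ g → (f +ₚ f′) *ₚ g ≋ f *ₚ g +ₚ f′ *ₚ g
  *ₚ-distribʳ [] f′ g = ≋-refl
  *ₚ-distribʳ (a ∷ f) [] g = ≋-sym (+ₚ-identityʳ ((a ∷ f) *ₚ g))
  *ₚ-distribʳ (a ∷ f) (b ∷ f′) g = mk≋ λ n → begin
    coeff ((a +F b ∷ f +ₚ f′) *ₚ g) n
      ≡⟨ coeff-∷*ₚ (a +F b) (f +ₚ f′) g n ⟩
    (a +F b) *F coeff g n +F coeff (0F ∷ (f +ₚ f′) *ₚ g) n
      ≡⟨ cong ((a +F b) *F coeff g n +F_) (shifted n) ⟩
    (a +F b) *F coeff g n +F (coeff (0F ∷ f *ₚ g) n +F coeff (0F ∷ f′ *ₚ g) n)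
      ≡⟨ distrib _ _ _ _ _ ⟩
    (a *F coeff g n +F coeff (0F ∷ f *ₚ g) n) +F (b *F coeff g n +F coeff (0F ∷ f′ *ₚ g) n)
      ≡⟨ sym (cong₂ _+F_ (coeff-∷*ₚ a f g n) (coeff-∷*ₚ b f′ g n)) ⟩
    coeff ((a ∷ f) *ₚ g) n +F coeff ((b ∷ f′) *ₚ g) n
      ≡⟨ sym (coeff-+ₚ ((a ∷ f) *ₚ g) ((b ∷ f′) *ₚ g) n) ⟩
    coeff ((a ∷ f) *ₚ g +ₚ (b ∷ f′) *ₚ g) n ∎
    where
    open ≡-Reasoning
    open FieldSolver
    distrib : ∀ a b x y z → (a +F b) *F x +F (y +F z) ≡ (a *F x +F y) +F (b *F x +F z)
    distrib = solve 5 (λ a b x y z → (a :+ b) :* x :+ (y :+ z) := (a :* x :+ y) :+ (b :* x :+ z)) refl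
    shifted : ∀ n → coeff (0F ∷ (f +ₚ f′) *ₚ g) n ≡ coeff (0F ∷ f *ₚ g) n +F coeff (0F ∷ f′ *ₚ g) n
    shifted zero = sym (F.+-identityˡ 0F)
    shifted (suc n) = trans (coeff-≡ (*ₚ-distribʳ f f′ g) n) (coeff-+ₚ (f *ₚ g) (f′ *ₚ g) n)

  0∷-*ₚ : ∀ f g → (0F ∷ f) *ₚ g ≋ 0F ∷ f *ₚ g
  0∷-*ₚ f g = mk≋ λ n →
    trans (coeff-∷*ₚ 0F f g n) (trans (cong (_+F coeff (0F ∷ f *ₚ g) n) (F.zeroˡ _)) (F.+-identityˡ _))

  *ₚ-assoc : ∀ f g h → (f *ₚ g) *ₚ h ≋ f *ₚ (g *ₚ h)
  *ₚ-assoc [] g h = ≋-refl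
  *ₚ-assoc (a ∷ f) g h =
    ≋-trans (*ₚ-distribʳ (scale a g) (0F ∷ f *ₚ g) h)
            (+ₚ-cong (scale-*ₚ a g h) (≋-trans (0∷-*ₚ (f *ₚ g) h) (∷-cong refl (*ₚ-assoc f g h))))

  1ₚ : Pol
  1ₚ = 1F ∷ []

  constant : F → Pol
  constant a = a ∷ []

  constant-*ₚ : ∀ a h → constant a *ₚ h ≋ scale a h
  constant-*ₚ a h = mk≋ λ n →
    trans (coeff-+ₚ (scale a h) (0F ∷ []) n) (trans (cong (coeff (scale a h) n +F_) (zero-tail n)) (F.+-identityʳ _))
    where
    zero-tail : ∀ n → coeff (0F ∷ []) n ≡ 0F
    zero-tail zero = refl
    zero-tail (suc n) = refl

  *ₚ-identityˡ : ∀ f → 1ₚ *ₚ f ≋ f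
  *ₚ-identityˡ f = ≋-trans (constant-*ₚ 1F f) (mk≋ λ n → trans (coeff-scale 1F f n) (F.*-identityˡ _))

  *ₚ-identityʳ : ∀ f → f *ₚ 1ₚ ≋ f
  *ₚ-identityʳ f = ≋-trans (*ₚ-comm f 1ₚ) (*ₚ-identityˡ f)

  *ₚ-distribˡ : ∀ f g g′ → f *ₚ (g +ₚ g′) ≋ f *ₚ g +ₚ f *ₚ g′
  *ₚ-distribˡ f g g′ =
    ≋-trans (*ₚ-comm f (g +ₚ g′)) (≋-trans (*ₚ-distribʳ g g′ f) (+ₚ-cong (*ₚ-comm g f) (*ₚ-comm g′ f)))

  isCommutativeRingₚ : IsCommutativeRing _≋_ _+ₚ_ _*ₚ_ negₚ [] 1ₚ
  isCommutativeRingₚ = record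
    { isRing = record
      { +-isAbelianGroup = record
        { isGroup = record
          { isMonoid = record
            { isSemigroup = record
              { isMagma = record
                { isEquivalence = record { refl = ≋-refl ; sym = ≋-sym ; trans = ≋-trans }
                ; ∙-cong = +ₚ-cong }
              ; assoc = +ₚ-assoc }
            ; identity = (λ f → ≋-refl) , +ₚ-identityʳ }
          ; inverse = +ₚ-inverseˡ , +ₚ-inverseʳ
          ; ⁻¹-cong = negₚ-cong }
        ; comm = +ₚ-comm }
      ; *-cong = *ₚ-cong
      ; *-assoc = *ₚ-assoc
      ; *-identity = *ₚ-identityˡ , *ₚ-identityʳ
      ; distrib = *ₚ-distribˡ , λ g f f′ → *ₚ-distribʳ f f′ g }
    ; *-comm = *ₚ-comm }

  commutativeRingₚ : CommutativeRing _ _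
  commutativeRingₚ = record { isCommutativeRing = isCommutativeRingₚ }

  module ≋-Reasoning = SetoidReasoning (CommutativeRing.setoid commutativeRingₚ)
  module PolySolver = NaturalCoefficients (CommutativeRing.commutativeSemiring commutativeRingₚ)
  private
    module +ₚ-Group = GroupProperties (CommutativeRing.+-group commutativeRingₚ)
    module Ringₚ = RingProperties (CommutativeRing.ring commutativeRingₚ)
    module +ₚ-Abelian = AbelianGroupProperties (CommutativeRing.+-abelianGroup commutativeRingₚ)

  -- Degree

  record DegreeBelow (m : ℕ) (f : Pol) : Set where
    constructor degreeBelow
    field vanishes : ∀ k → m ≤ k → coeff f k ≡ 0F
  open DegreeBelow public

  DegreeBelow-resp-≋ : ∀ {m f g} → f ≋ g → DegreeBelow m f → DegreeBelow m g
  DegreeBelow-resp-≋ e d = degreeBelow λ k m≤k → trans (sym (coeff-≡ e k)) (vanishes d k m≤k)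

  DegreeBelow-mono : ∀ {m n f} → m ≤ n → DegreeBelow m f → DegreeBelow n f
  DegreeBelow-mono m≤n d = degreeBelow λ k n≤k → vanishes d k (ℕ.≤-trans m≤n n≤k)

  DegreeBelow-0⇒≋[] : ∀ {f} → DegreeBelow 0 f → f ≋ []
  DegreeBelow-0⇒≋[] d = mk≋ λ n → vanishes d n z≤n

  ≋[]⇒DegreeBelow-0 : ∀ {f} → f ≋ [] → DegreeBelow 0 f
  ≋[]⇒DegreeBelow-0 e = degreeBelow λ k _ → coeff-≡ e k

  DegreeBelow-[] : ∀ {m} → DegreeBelow m []
  DegreeBelow-[] = degreeBelow λ _ _ → refl

  DegreeBelow-∷ : ∀ {m a f} → DegreeBelow m f → DegreeBelow (suc m) (a ∷ f)
  DegreeBelow-∷ d = degreeBelow λ { zero () ; (suc k) (s≤s m≤k) → vanishes d k m≤k }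

  DegreeBelow-tail : ∀ {m a f} → DegreeBelow (suc m) (a ∷ f) → DegreeBelow m f
  DegreeBelow-tail d = degreeBelow λ k m≤k → vanishes d (suc k) (s≤s m≤k)

  sizeCons : F → ℕ → ℕ
  sizeCons a (suc m) = suc (suc m)
  sizeCons a zero with a ≟F 0F
  ... | yes _ = 0
  ... | no _ = 1

  -- size f is deg f + 1 for a nonzero f, and 0 for the zero polynomial (trailing zeros are ignored).
  size : Pol → ℕ
  size [] = 0
  size (a ∷ f) = sizeCons a (size f)

  DegreeBelow-size : ∀ f → DegreeBelow (size f) f
  DegreeBelow-size [] = DegreeBelow-[]
  DegreeBelow-size (a ∷ f) with size f | DegreeBelow-size f
  ... | suc m | d = DegreeBelow-∷ d
  ... | zero | d with a ≟F 0F
  ...   | yes a≡0 = degreeBelow λ { zero _ → a≡0 ; (suc k) _ → vanishes d k z≤n }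
  ...   | no _ = DegreeBelow-∷ d

  size-leading : ∀ f m → size f ≡ suc m → ¬ (coeff f m ≡ 0F)
  size-leading [] m ()
  size-leading (a ∷ f) m with size f | size-leading f
  ... | suc m′ | leading = λ { refl → leading m′ refl }
  ... | zero | _ with a ≟F 0F
  ...   | yes _ = λ ()
  ...   | no a≢0 = λ { refl → a≢0 }

  DegreeBelow⇒size≤ : ∀ {m f} → DegreeBelow m f → size f ≤ m
  DegreeBelow⇒size≤ {m} {f} d with size f in eq
  ... | zero = z≤n
  ... | suc j with m ℕ.≤? j
  ...   | yes m≤j = ⊥-elim (size-leading f j eq (vanishes d j m≤j))
  ...   | no m≰j = ℕ.≰⇒> m≰j

  size≤⇒DegreeBelow : ∀ {m f} → size f ≤ m → DegreeBelow m f
  size≤⇒DegreeBelow {m} {f} s≤m = DegreeBelow-mono s≤m (DegreeBelow-size f)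

  size≡⇒DegreeBelow : ∀ f {m} → size f ≡ m → DegreeBelow m f
  size≡⇒DegreeBelow f refl = DegreeBelow-size f

  size-cong : ∀ {f g} → f ≋ g → size f ≡ size g
  size-cong {f} {g} e = ℕ.≤-antisym
    (DegreeBelow⇒size≤ (DegreeBelow-resp-≋ (≋-sym e) (DegreeBelow-size g)))
    (DegreeBelow⇒size≤ (DegreeBelow-resp-≋ e (DegreeBelow-size f)))

  size≡0⇒≋[] : ∀ {f} → size f ≡ 0 → f ≋ []
  size≡0⇒≋[] {f} e = DegreeBelow-0⇒≋[] (size≡⇒DegreeBelow f e)

  ≋[]⇒size≡0 : ∀ {f} → f ≋ [] → size f ≡ 0
  ≋[]⇒size≡0 e = ℕ.n≤0⇒n≡0 (DegreeBelow⇒size≤ (≋[]⇒DegreeBelow-0 e))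

  size-exact : ∀ {m f} → DegreeBelow (suc m) f → ¬ (coeff f m ≡ 0F) → size f ≡ suc m
  size-exact {m} {f} d fₘ≢0 = ℕ.≤-antisym (DegreeBelow⇒size≤ d) m<size
    where
    m<size : m < size f
    m<size with m ℕ.<? size f
    ... | yes m<s = m<s
    ... | no m≮s = ⊥-elim (fₘ≢0 (vanishes (DegreeBelow-size f) m (ℕ.≮⇒≥ m≮s)))

  Nonzero : Pol → Set
  Nonzero f = ¬ (f ≋ [])

  ≋[]? : ∀ f → Dec (f ≋ [])
  ≋[]? f with size f ℕ.≟ 0
  ... | yes s≡0 = yes (size≡0⇒≋[] s≡0)
  ... | no s≢0 = no (s≢0 ∘ ≋[]⇒size≡0)

  Nonzero⇒size≡suc : ∀ {f} → Nonzero f → ∃ λ m → size f ≡ suc m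
  Nonzero⇒size≡suc {f} f≢0 with size f in eq
  ... | zero = ⊥-elim (f≢0 (size≡0⇒≋[] eq))
  ... | suc m = m , refl

  DegreeBelow-*ₚ : ∀ i j {f g} → DegreeBelow (suc i) f → DegreeBelow (suc j) g → DegreeBelow (suc (i + j)) (f *ₚ g)
  DegreeBelow-*ₚ i j {[]} df dg = DegreeBelow-[]
  DegreeBelow-*ₚ i j {a ∷ f} {g} df dg = degreeBelow λ k i+j<k →
    trans (coeff-∷*ₚ a f g k)
      (trans (cong₂ _+F_ (trans (cong (a *F_) (vanishes dg k (ℕ.≤-trans (s≤s (ℕ.m≤n+m j i)) i+j<k))) (F.zeroʳ a))
                         (shifted i k i+j<k df))
             (F.+-identityˡ 0F))
    where
    shifted : ∀ i k → suc (i + j) ≤ k → DegreeBelow (suc i) (a ∷ f) → coeff (0F ∷ f *ₚ g) k ≡ 0F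
    shifted zero (suc k) _ d = coeff-≡ (*ₚ-zeroˡ {f} g (DegreeBelow-0⇒≋[] (DegreeBelow-tail d))) k
    shifted (suc i) (suc k) (s≤s i+j<k) d = vanishes (DegreeBelow-*ₚ i j (DegreeBelow-tail d) dg) k i+j<k

  coeff-*ₚ-top : ∀ i j {f g} → DegreeBelow (suc i) f → DegreeBelow (suc j) g →
    coeff (f *ₚ g) (i + j) ≡ coeff f i *F coeff g j
  coeff-*ₚ-top i j {[]} df dg = sym (F.zeroˡ _)
  coeff-*ₚ-top zero j {a ∷ f} {g} df dg =
    trans (coeff-∷*ₚ a f g j) (trans (cong (a *F coeff g j +F_) (shifted j)) (F.+-identityʳ _))
    where
    shifted : ∀ j → coeff (0F ∷ f *ₚ g) j ≡ 0F
    shifted zero = refl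
    shifted (suc j) = coeff-≡ (*ₚ-zeroˡ {f} g (DegreeBelow-0⇒≋[] (DegreeBelow-tail df))) j
  coeff-*ₚ-top (suc i) j {a ∷ f} {g} df dg =
    trans (coeff-∷*ₚ a f g (suc (i + j)))
      (trans (cong₂ _+F_ (trans (cong (a *F_) (vanishes dg (suc (i + j)) (s≤s (ℕ.m≤n+m j i)))) (F.zeroʳ a))
                         (coeff-*ₚ-top i j (DegreeBelow-tail df) dg))
             (F.+-identityˡ _))

  size-*ₚ : ∀ {f g i j} → size f ≡ suc i → size g ≡ suc j → size (f *ₚ g) ≡ suc (i + j)
  size-*ₚ {f} {g} {i} {j} sf sg = size-exact (DegreeBelow-*ₚ i j df dg) λ top≡0 →
    *-nonzero (size-leading f i sf) (size-leading g j sg) (trans (sym (coeff-*ₚ-top i j df dg)) top≡0)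
    where
    df = size≡⇒DegreeBelow f sf
    dg = size≡⇒DegreeBelow g sg

  *ₚ-nonzero : ∀ {f g} → Nonzero f → Nonzero g → Nonzero (f *ₚ g)
  *ₚ-nonzero {f} {g} f≢0 g≢0 fg≋0 with Nonzero⇒size≡suc f≢0 | Nonzero⇒size≡suc g≢0
  ... | i , sf | j , sg with trans (sym (size-*ₚ {f} {g} sf sg)) (≋[]⇒size≡0 fg≋0)
  ... | ()

  f-g≋[]⇒f≋g : ∀ {f g} → f +ₚ negₚ g ≋ [] → f ≋ g
  f-g≋[]⇒f≋g {f} {g} = +ₚ-Group.x∙y⁻¹≈ε⇒x≈y f g

  f≋g⇒f-g≋[] : ∀ {f g} → f ≋ g → f +ₚ negₚ g ≋ []
  f≋g⇒f-g≋[] {f} {g} = +ₚ-Group.x≈y⇒x∙y⁻¹≈ε {f} {g}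

  *ₚ-cancelˡ : ∀ {f g h} → Nonzero f → f *ₚ g ≋ f *ₚ h → g ≋ h
  *ₚ-cancelˡ {f} {g} {h} f≢0 fg≋fh with ≋[]? (g +ₚ negₚ h)
  ... | yes g-h≋0 = f-g≋[]⇒f≋g g-h≋0
  ... | no g-h≢0 = ⊥-elim (*ₚ-nonzero f≢0 g-h≢0 (begin
    f *ₚ (g +ₚ negₚ h)          ≈⟨ *ₚ-distribˡ f g (negₚ h) ⟩
    f *ₚ g +ₚ f *ₚ negₚ h       ≈⟨ +ₚ-cong ≋-refl (≋-sym (Ringₚ.-‿distribʳ-* f h)) ⟩
    f *ₚ g +ₚ negₚ (f *ₚ h)     ≈⟨ f≋g⇒f-g≋[] fg≋fh ⟩
    []                          ∎))
    where open ≋-Reasoning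

  -- Division with remainder and greatest common divisors

  x+y+[z-x]≋y+z : ∀ x y z → (x +ₚ y) +ₚ (z +ₚ negₚ x) ≋ y +ₚ z
  x+y+[z-x]≋y+z x y z = begin
    (x +ₚ y) +ₚ (z +ₚ negₚ x)   ≈⟨ ≋-sym (+ₚ-assoc (x +ₚ y) z (negₚ x)) ⟩
    ((x +ₚ y) +ₚ z) +ₚ negₚ x   ≈⟨ +ₚ-cong (+ₚ-assoc x y z) ≋-refl ⟩
    (x +ₚ (y +ₚ z)) +ₚ negₚ x   ≈⟨ +ₚ-Abelian.xyx⁻¹≈y x (y +ₚ z) ⟩
    y +ₚ z                      ∎
    where open ≋-Reasoning

  divMod : ∀ n b → size b ≡ suc n → ∀ f →
    ∃ λ quot → ∃ λ rem → f ≋ b *ₚ quot +ₚ rem × DegreeBelow n rem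
  divMod n b sb [] = [] , [] , ≋-sym (≋-trans (+ₚ-identityʳ (b *ₚ [])) (*ₚ-zeroʳ b)) , DegreeBelow-[]
  divMod n b sb (a ∷ f) with divMod n b sb f
  ... | quot , rem , f≋ , deg = s ∷ quot , h +ₚ negₚ (scale s b) , a∷f≋ , deg′
    where
    -- h = a ∷ rem has degree ≤ n; subtracting s·b kills its coefficient of degree n.
    h = a ∷ rem
    c≢0 = size-leading b n sb
    s = coeff h n *F inv (coeff b n) c≢0
    a∷f≋ : a ∷ f ≋ b *ₚ (s ∷ quot) +ₚ (h +ₚ negₚ (scale s b))
    a∷f≋ = begin
      a ∷ f                                                          ≈⟨ ∷-cong (sym (F.+-identityˡ a)) f≋ ⟩
      (0F ∷ b *ₚ quot) +ₚ h                                          ≈⟨ ≋-sym (x+y+[z-x]≋y+z (scale s b) _ h) ⟩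
      (scale s b +ₚ (0F ∷ b *ₚ quot)) +ₚ (h +ₚ negₚ (scale s b))    ≈⟨ +ₚ-cong (≋-sym (*ₚ-∷ʳ b s quot)) ≋-refl ⟩
      b *ₚ (s ∷ quot) +ₚ (h +ₚ negₚ (scale s b))                     ∎
      where open ≋-Reasoning
    coeff-h-sb : ∀ k → coeff (h +ₚ negₚ (scale s b)) k ≡ coeff h k +F -F (s *F coeff b k)
    coeff-h-sb k = trans (coeff-+ₚ h (negₚ (scale s b)) k)
      (cong (coeff h k +F_) (trans (coeff-negₚ (scale s b) k) (cong -F_ (coeff-scale s b k))))
    s*lc≡hₙ : s *F coeff b n ≡ coeff h n
    s*lc≡hₙ = trans (F.*-assoc _ _ _) (trans (cong (coeff h n *F_) (*-inverseˡ _ c≢0)) (F.*-identityʳ _))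
    deg′ : DegreeBelow n (h +ₚ negₚ (scale s b))
    deg′ = degreeBelow λ k n≤k → trans (coeff-h-sb k) (vanish k (ℕ.m≤n⇒m<n∨m≡n n≤k))
      where
      vanish : ∀ k → n < k ⊎ n ≡ k → coeff h k +F -F (s *F coeff b k) ≡ 0F
      vanish k (inj₁ n<k) =
        trans (cong₂ _+F_ (vanishes (DegreeBelow-∷ deg) k n<k)
                          (cong -F_ (trans (cong (s *F_) (vanishes (size≡⇒DegreeBelow b sb) k n<k)) (F.zeroʳ s))))
              (trans (F.+-identityˡ _) -F0≡0)
      vanish k (inj₂ refl) = trans (cong (λ x → coeff h n +F -F x) s*lc≡hₙ) (F.-‿inverseʳ _)

  infix 4 _∣_
  record _∣_ (d f : Pol) : Set where
    constructor divides
    field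
      quotient : Pol
      equation : d *ₚ quotient ≋ f

  ∣-refl : ∀ {f} → f ∣ f
  ∣-refl {f} = divides 1ₚ (*ₚ-identityʳ f)

  ∣-respʳ-≋ : ∀ {d f f′} → f ≋ f′ → d ∣ f → d ∣ f′
  ∣-respʳ-≋ e (divides h dh≋f) = divides h (≋-trans dh≋f e)

  ∣-respˡ-≋ : ∀ {d d′ f} → d ≋ d′ → d ∣ f → d′ ∣ f
  ∣-respˡ-≋ {d} {d′} e (divides h dh≋f) = divides h (≋-trans (*ₚ-congˡ h (≋-sym e)) dh≋f)

  ∣-trans : ∀ {a b c} → a ∣ b → b ∣ c → a ∣ c
  ∣-trans {a} {b} {c} (divides h ah≋b) (divides k bk≋c) =
    divides (h *ₚ k) (≋-trans (≋-sym (*ₚ-assoc a h k)) (≋-trans (*ₚ-congˡ k ah≋b) bk≋c))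

  ∣-+ₚ : ∀ {d f g} → d ∣ f → d ∣ g → d ∣ f +ₚ g
  ∣-+ₚ {d} (divides h dh≋f) (divides k dk≋g) = divides (h +ₚ k) (≋-trans (*ₚ-distribˡ d h k) (+ₚ-cong dh≋f dk≋g))

  ∣-*ₚˡ : ∀ {d f} c → d ∣ f → d ∣ c *ₚ f
  ∣-*ₚˡ {d} {f} c (divides h dh≋f) =
    divides (h *ₚ c) (≋-trans (≋-sym (*ₚ-assoc d h c)) (≋-trans (*ₚ-congˡ c dh≋f) (*ₚ-comm f c)))

  ∣-[] : ∀ {d} → d ∣ []
  ∣-[] {d} = divides [] (*ₚ-zeroʳ d)

  data InIdeal (gens : List Pol) : Pol → Set where
    gen : ∀ {f} → f ∈ gens → InIdeal gens f
    nil : InIdeal gens []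
    add : ∀ {f g} → InIdeal gens f → InIdeal gens g → InIdeal gens (f +ₚ g)
    mul : ∀ {f} c → InIdeal gens f → InIdeal gens (c *ₚ f)
    resp-≋ : ∀ {f g} → f ≋ g → InIdeal gens f → InIdeal gens g

  All∣⇒∣InIdeal : ∀ {gens d f} → All (d ∣_) gens → InIdeal gens f → d ∣ f
  All∣⇒∣InIdeal ds (gen m) = All.lookup ds m
  All∣⇒∣InIdeal ds nil = ∣-[]
  All∣⇒∣InIdeal ds (add i j) = ∣-+ₚ (All∣⇒∣InIdeal ds i) (All∣⇒∣InIdeal ds j)
  All∣⇒∣InIdeal ds (mul c i) = ∣-*ₚˡ c (All∣⇒∣InIdeal ds i)
  All∣⇒∣InIdeal ds (resp-≋ e i) = ∣-respʳ-≋ e (All∣⇒∣InIdeal ds i)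

  InIdeal-*ₚ : ∀ {gens f} h → InIdeal gens f → InIdeal (map (h *ₚ_) gens) (h *ₚ f)
  InIdeal-*ₚ h (gen m) = gen (∈-map⁺ (h *ₚ_) m)
  InIdeal-*ₚ h nil = resp-≋ (≋-sym (*ₚ-zeroʳ h)) nil
  InIdeal-*ₚ h (add {f} {g} i j) = resp-≋ (≋-sym (*ₚ-distribˡ h f g)) (add (InIdeal-*ₚ h i) (InIdeal-*ₚ h j))
  InIdeal-*ₚ h (mul {f} c i) = resp-≋ (PolySolver.solve 3 (λ c h f → c :* (h :* f) := h :* (c :* f)) ≋-refl c h f)
                                     (mul c (InIdeal-*ₚ h i))
    where open PolySolver using (_:*_; _:=_)
  InIdeal-*ₚ h (resp-≋ e i) = resp-≋ (*ₚ-congʳ h e) (InIdeal-*ₚ h i)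

  -- Euclid's algorithm, with fuel bounding the size of the second argument.
  euclid : ∀ fuel gens f g → size g < fuel → InIdeal gens f → InIdeal gens g →
    ∃ λ d → InIdeal gens d × d ∣ f × d ∣ g
  euclid (suc fuel) gens f g sg<fuel if ig with ≋[]? g
  ... | yes g≋0 = f , if , ∣-refl , ∣-respʳ-≋ (≋-sym g≋0) ∣-[]
  ... | no g≢0 with Nonzero⇒size≡suc g≢0
  ...   | n , sg with divMod n g sg f
  ...     | quot , rem , f≋ , deg with euclid fuel gens g rem size-rem ig irem
    where
    size-rem : size rem < fuel
    size-rem = ℕ.<-≤-trans (s≤s (DegreeBelow⇒size≤ deg)) (ℕ.≤-pred (subst (_< suc fuel) sg sg<fuel))
    irem : InIdeal gens rem
    irem = resp-≋ f-quot*g≋rem (add if (mul (negₚ quot) ig))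
      where
      open ≋-Reasoning
      f-quot*g≋rem : f +ₚ negₚ quot *ₚ g ≋ rem
      f-quot*g≋rem = begin
        f +ₚ negₚ quot *ₚ g                       ≈⟨ +ₚ-cong f≋ (≋-sym (Ringₚ.-‿distribˡ-* quot g)) ⟩
        (g *ₚ quot +ₚ rem) +ₚ negₚ (quot *ₚ g)    ≈⟨ +ₚ-cong ≋-refl (negₚ-cong (*ₚ-comm quot g)) ⟩
        (g *ₚ quot +ₚ rem) +ₚ negₚ (g *ₚ quot)    ≈⟨ +ₚ-Abelian.xyx⁻¹≈y (g *ₚ quot) rem ⟩
        rem                                       ∎
  ...       | d , id , d∣g , d∣rem =
    d , id , ∣-respʳ-≋ (≋-sym f≋) (∣-+ₚ (∣-respʳ-≋ (*ₚ-comm quot g) (∣-*ₚˡ quot d∣g)) d∣rem) , d∣g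

  idealGcd : ∀ gens → ∃ λ d → InIdeal gens d × All (d ∣_) gens
  idealGcd gens with fold gens gen [] nil
    where
    fold : ∀ fs → (∀ {f} → f ∈ fs → InIdeal gens f) → ∀ d₀ → InIdeal gens d₀ →
      ∃ λ d → InIdeal gens d × d ∣ d₀ × All (d ∣_) fs
    fold [] _ d₀ i₀ = d₀ , i₀ , ∣-refl , []
    fold (f ∷ fs) fs⊆ d₀ i₀ with euclid (suc (size f)) gens d₀ f ℕ.≤-refl i₀ (fs⊆ (here refl))
    ... | d₁ , i₁ , d₁∣d₀ , d₁∣f with fold fs (fs⊆ ∘ there) d₁ i₁
    ...   | d , i , d∣d₁ , ds = d , i , ∣-trans d∣d₁ d₁∣d₀ , ∣-trans d∣d₁ d₁∣f ∷ ds
  ... | d , i , _ , ds = d , i , ds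

  1ₚ-nonzero : Nonzero 1ₚ
  1ₚ-nonzero e = 1≢0 (coeff-≡ e zero)

  constant-nonzero : ∀ {a} → ¬ (a ≡ 0F) → Nonzero (constant a)
  constant-nonzero a≢0 e = a≢0 (coeff-≡ e zero)

  size-constant : ∀ {a} → ¬ (a ≡ 0F) → size (constant a) ≡ 1
  size-constant a≢0 = size-exact (DegreeBelow-∷ DegreeBelow-[]) a≢0

  size≡1⇒≋constant : ∀ {u} → size u ≡ 1 → u ≋ constant (coeff u 0)
  size≡1⇒≋constant {u} su = mk≋ λ where
    zero → refl
    (suc k) → vanishes (size≡⇒DegreeBelow u su) (suc k) (s≤s z≤n)

  size≡1⇒∣1ₚ : ∀ {u} → size u ≡ 1 → u ∣ 1ₚ
  size≡1⇒∣1ₚ {u} su = ∣-respˡ-≋ (≋-sym (size≡1⇒≋constant su))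
    (divides (constant (inv c c≢0)) (≋-trans (constant-*ₚ c (constant (inv c c≢0))) (∷-cong (*-inverseʳ c c≢0) ≋-refl)))
    where
    c = coeff u 0
    c≢0 = size-leading u 0 su

  ∣⇒size≤ : ∀ {d f} → d ∣ f → Nonzero f → size d ≤ size f
  ∣⇒size≤ {d} {f} (divides h dh≋f) f≢0 with ≋[]? d | ≋[]? h
  ... | yes d≋0 | _ = ⊥-elim (f≢0 (≋-trans (≋-sym dh≋f) (*ₚ-zeroˡ h d≋0)))
  ... | no _ | yes h≋0 = ⊥-elim (f≢0 (≋-trans (≋-sym dh≋f) (≋-trans (*ₚ-comm d h) (*ₚ-zeroˡ d h≋0))))
  ... | no d≢0 | no h≢0 with Nonzero⇒size≡suc d≢0 | Nonzero⇒size≡suc h≢0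
  ...   | i , sd | j , sh = begin
    size d               ≡⟨ sd ⟩
    suc i                ≤⟨ s≤s (ℕ.m≤m+n i j) ⟩
    suc (i + j)          ≡⟨ sym (size-*ₚ {d} {h} sd sh) ⟩
    size (d *ₚ h)        ≡⟨ size-cong dh≋f ⟩
    size f               ∎
    where open ℕ.≤-Reasoning

  ∣1ₚ⇒size≡1 : ∀ {u} → u ∣ 1ₚ → size u ≡ 1
  ∣1ₚ⇒size≡1 {u} u∣1@(divides h uh≋1) with ≋[]? u
  ... | yes u≋0 = ⊥-elim (1ₚ-nonzero (≋-trans (≋-sym uh≋1) (*ₚ-zeroˡ h u≋0)))
  ... | no u≢0 = ℕ.≤-antisym (ℕ.≤-trans (∣⇒size≤ u∣1 1ₚ-nonzero) (ℕ.≤-reflexive (size-constant 1≢0)))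
                             (subst (1 ≤_) (sym (proj₂ (Nonzero⇒size≡suc u≢0))) (s≤s z≤n))

  ∣-cancelˡ : ∀ {g d f} → Nonzero g → g *ₚ d ∣ g *ₚ f → d ∣ f
  ∣-cancelˡ {g} {d} {f} g≢0 (divides k gdk≋gf) =
    divides k (*ₚ-cancelˡ g≢0 (≋-trans (≋-sym (*ₚ-assoc g d k)) gdk≋gf))

  -- Reduced lists and unique factorization

  IsZero⇒≋[] : ∀ {f} → IsZero f → f ≋ []
  IsZero⇒≋[] [] = ≋-refl
  IsZero⇒≋[] (a≡0 ∷ f≡0) = mk≋ λ { zero → a≡0 ; (suc k) → coeff-≡ (IsZero⇒≋[] f≡0) k }

  ≋[]⇒IsZero : ∀ {f} → f ≋ [] → IsZero f
  ≋[]⇒IsZero {[]} e = []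
  ≋[]⇒IsZero {a ∷ f} e = coeff-≡ e zero ∷ ≋[]⇒IsZero (mk≋ λ k → coeff-≡ e (suc k))

  ∣ₚ⇒∣ : ∀ {g f} → g ∣ₚ f → g ∣ f
  ∣ₚ⇒∣ (h , gh≈f) = divides h (f-g≋[]⇒f≋g (IsZero⇒≋[] gh≈f))

  ∣⇒∣ₚ : ∀ {g f} → g ∣ f → g ∣ₚ f
  ∣⇒∣ₚ (divides h gh≋f) = h , ≋[]⇒IsZero (f≋g⇒f-g≋[] gh≋f)

  IsMonic : Pol → Set
  IsMonic f = ∃ λ m → size f ≡ suc m × coeff f m ≡ 1F

  IsMonic⇒Nonzero : ∀ {f} → IsMonic f → Nonzero f
  IsMonic⇒Nonzero (m , _ , fₘ≡1) f≋0 = 1≢0 (trans (sym fₘ≡1) (coeff-≡ f≋0 m))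

  IsMonic-resp-≋ : ∀ {f g} → f ≋ g → IsMonic f → IsMonic g
  IsMonic-resp-≋ e (m , sf , fₘ≡1) = m , trans (sym (size-cong e)) sf , trans (sym (coeff-≡ e m)) fₘ≡1

  Monic⇒IsMonic : ∀ {f} → Monic f → IsMonic f
  Monic⇒IsMonic (as , bs , refl , bs≡0) = go as
    where
    go : ∀ as → IsMonic (as ++ 1F ∷ bs)
    go [] = 0 , size-exact (DegreeBelow-∷ (≋[]⇒DegreeBelow-0 (IsZero⇒≋[] bs≡0))) 1≢0 , refl
    go (a ∷ as) with go as
    ... | m , s , c = suc m , cong (sizeCons a) s , c

  IsMonic⇒Monic : ∀ {f} → IsMonic f → Monic f
  IsMonic⇒Monic {f} (m , sf , fₘ≡1) = split m f fₘ≡1 (size≡⇒DegreeBelow f sf)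
    where
    split : ∀ m f → coeff f m ≡ 1F → DegreeBelow (suc m) f → Monic f
    split zero [] 0≡1 _ = ⊥-elim (0≢1 0≡1)
    split zero (a ∷ f) a≡1 d = [] , f , cong (_∷ f) a≡1 , ≋[]⇒IsZero (DegreeBelow-0⇒≋[] (DegreeBelow-tail d))
    split (suc m) [] 0≡1 _ = ⊥-elim (0≢1 0≡1)
    split (suc m) (a ∷ f) fₘ≡1 d with split m f fₘ≡1 (DegreeBelow-tail d)
    ... | as , bs , refl , bs≡0 = a ∷ as , bs , refl , bs≡0

  isMonic? : ∀ f → Dec (IsMonic f)
  isMonic? f with size f in sf
  ... | zero = no λ { (m , () , _) }
  ... | suc m with coeff f m ≟F 1F
  ...   | yes fₘ≡1 = yes (m , refl , fₘ≡1)
  ...   | no fₘ≢1 = no λ { (m′ , refl , fₘ′≡1) → fₘ≢1 fₘ′≡1 }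

  FirstNonzeroIsMonic : List Pol → Set
  FirstNonzeroIsMonic [] = ⊥
  FirstNonzeroIsMonic (f ∷ fs) = (f ≋ [] × FirstNonzeroIsMonic fs) ⊎ IsMonic f

  firstNonzeroIsMonic? : ∀ fs → Dec (FirstNonzeroIsMonic fs)
  firstNonzeroIsMonic? [] = no λ ()
  firstNonzeroIsMonic? (f ∷ fs) with isMonic? f | ≋[]? f | firstNonzeroIsMonic? fs
  ... | yes m | _ | _ = yes (inj₂ m)
  ... | no ¬m | yes f≋0 | yes r = yes (inj₁ (f≋0 , r))
  ... | no ¬m | yes _ | no ¬r = no λ { (inj₁ (_ , r)) → ¬r r ; (inj₂ m) → ¬m m }
  ... | no ¬m | no f≢0 | _ = no λ { (inj₁ (f≋0 , _)) → f≢0 f≋0 ; (inj₂ m) → ¬m m }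

  Coprime : List Pol → Set
  Coprime fs = ∀ d → All (d ∣_) fs → d ∣ 1ₚ

  coprime? : ∀ fs → Dec (Coprime fs)
  coprime? fs with idealGcd fs
  ... | g , ig , g∣fs with size g ℕ.≟ 1
  ...   | yes sg≡1 = yes λ d d∣fs → ∣-trans (All∣⇒∣InIdeal d∣fs ig) (size≡1⇒∣1ₚ sg≡1)
  ...   | no sg≢1 = no λ cop → sg≢1 (∣1ₚ⇒size≡1 (cop g g∣fs))

  Coprime⇒1∈Ideal : ∀ {fs} → Coprime fs → InIdeal fs 1ₚ
  Coprime⇒1∈Ideal {fs} cop with idealGcd fs
  ... | g , ig , g∣fs with cop g g∣fs
  ...   | divides h gh≋1 = resp-≋ (≋-trans (*ₚ-comm h g) gh≋1) (mul h ig)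

  Reduced : List Pol → Set
  Reduced fs = FirstNonzeroIsMonic fs × Coprime fs

  reduced? : ∀ fs → Dec (Reduced fs)
  reduced? fs = firstNonzeroIsMonic? fs ×-dec coprime? fs

  infix 4 _*ₗ_≋_
  _*ₗ_≋_ : Pol → List Pol → List Pol → Set
  g *ₗ hs ≋ fs = Pointwise (λ h f → g *ₚ h ≋ f) hs fs

  *ₗ-All≋[]⁺ : ∀ {g hs fs} → g *ₗ hs ≋ fs → All (_≋ []) hs → All (_≋ []) fs
  *ₗ-All≋[]⁺ [] [] = []
  *ₗ-All≋[]⁺ {g} (_∷_ {h} gh≋f ps) (h≋0 ∷ hs≋0) =
    ≋-trans (≋-sym gh≋f) (≋-trans (*ₚ-comm g h) (*ₚ-zeroˡ g h≋0)) ∷ *ₗ-All≋[]⁺ {g} ps hs≋0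

  *ₗ-All≋[]⁻ : ∀ {g hs fs} → Nonzero g → g *ₗ hs ≋ fs → All (_≋ []) fs → All (_≋ []) hs
  *ₗ-All≋[]⁻ g≢0 [] [] = []
  *ₗ-All≋[]⁻ {g} g≢0 (gh≋f ∷ ps) (f≋0 ∷ fs≋0) =
    *ₚ-cancelˡ g≢0 (≋-trans gh≋f (≋-trans f≋0 (≋-sym (*ₚ-zeroʳ g)))) ∷ *ₗ-All≋[]⁻ {g} g≢0 ps fs≋0

  constant-*ₚ⁻ : ∀ a h → scale a h ≋ constant a *ₚ h
  constant-*ₚ⁻ a h = ≋-sym (constant-*ₚ a h)

  scale-nonzero : ∀ {a h} → ¬ (a ≡ 0F) → Nonzero h → Nonzero (scale a h)
  scale-nonzero {a} {h} a≢0 h≢0 ah≋0 = *ₚ-nonzero (constant-nonzero a≢0) h≢0 (≋-trans (constant-*ₚ a h) ah≋0)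

  scale-≋[] : ∀ {a h} → ¬ (a ≡ 0F) → scale a h ≋ [] → h ≋ []
  scale-≋[] {a} {h} a≢0 ah≋0 with ≋[]? h
  ... | yes h≋0 = h≋0
  ... | no h≢0 = ⊥-elim (scale-nonzero a≢0 h≢0 ah≋0)

  scale-1 : ∀ h → scale 1F h ≋ h
  scale-1 h = ≋-trans (constant-*ₚ⁻ 1F h) (*ₚ-identityˡ h)

  size-scale : ∀ {a h} → ¬ (a ≡ 0F) → size (scale a h) ≡ size h
  size-scale {a} {h} a≢0 with ≋[]? h
  ... | yes h≋0 = trans (≋[]⇒size≡0 (scale-cong refl h≋0)) (sym (≋[]⇒size≡0 h≋0))
  ... | no h≢0 with Nonzero⇒size≡suc h≢0
  ...   | j , sh = trans (size-cong (constant-*ₚ⁻ a h)) (trans (size-*ₚ {constant a} {h} (size-constant a≢0) sh) (sym sh))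

  IsMonic-scale⇒≡1 : ∀ {a h h′} → ¬ (a ≡ 0F) → h ≋ scale a h′ → IsMonic h → IsMonic h′ → a ≡ 1F
  IsMonic-scale⇒≡1 {a} {h} {h′} a≢0 h≋ah′ (m , sh , hₘ≡1) (m′ , sh′ , h′ₘ′≡1) = begin
    a                        ≡⟨ sym (F.*-identityʳ a) ⟩
    a *F 1F                  ≡⟨ cong (a *F_) (sym h′ₘ′≡1) ⟩
    a *F coeff h′ m′         ≡⟨ sym (coeff-scale a h′ m′) ⟩
    coeff (scale a h′) m′    ≡⟨ sym (coeff-≡ h≋ah′ m′) ⟩
    coeff h m′               ≡⟨ cong (coeff h) (sym m≡m′) ⟩
    coeff h m                ≡⟨ hₘ≡1 ⟩
    1F                       ∎
    where
    open ≡-Reasoning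
    m≡m′ : m ≡ m′
    m≡m′ = ℕ.suc-injective (trans (sym sh) (trans (size-cong h≋ah′) (trans (size-scale {a} {h′} a≢0) sh′)))

  FirstNonzeroIsMonic-scale⇒≡1 : ∀ {a hs hs′} → ¬ (a ≡ 0F) → Pointwise (λ h h′ → h ≋ scale a h′) hs hs′ →
    FirstNonzeroIsMonic hs → FirstNonzeroIsMonic hs′ → a ≡ 1F
  FirstNonzeroIsMonic-scale⇒≡1 a≢0 (e ∷ es) (inj₁ (_ , r)) (inj₁ (_ , r′)) = FirstNonzeroIsMonic-scale⇒≡1 a≢0 es r r′
  FirstNonzeroIsMonic-scale⇒≡1 a≢0 (e ∷ es) (inj₁ (h≋0 , _)) (inj₂ m′) =
    ⊥-elim (IsMonic⇒Nonzero m′ (scale-≋[] a≢0 (≋-trans (≋-sym e) h≋0)))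
  FirstNonzeroIsMonic-scale⇒≡1 a≢0 (e ∷ es) (inj₂ m) (inj₁ (h′≋0 , _)) =
    ⊥-elim (IsMonic⇒Nonzero m (≋-trans e (scale-cong refl h′≋0)))
  FirstNonzeroIsMonic-scale⇒≡1 a≢0 (e ∷ es) (inj₂ m) (inj₂ m′) = IsMonic-scale⇒≡1 a≢0 e m m′

  -- 1 lies in the ideal of the h′ᵢ, so g′ = g′·1 lies in the ideal of the g′h′ᵢ = g hᵢ.
  Coprime⇒∣ : ∀ {g g′ hs hs′} → Coprime hs′ → Pointwise (λ h h′ → g *ₚ h ≋ g′ *ₚ h′) hs hs′ → g ∣ g′
  Coprime⇒∣ {g} {g′} cop ps =
    ∣-respʳ-≋ (*ₚ-identityʳ g′) (All∣⇒∣InIdeal (divides-all ps) (InIdeal-*ₚ g′ (Coprime⇒1∈Ideal cop)))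
    where
    divides-all : ∀ {hs hs′} → Pointwise (λ h h′ → g *ₚ h ≋ g′ *ₚ h′) hs hs′ →
      All (g ∣_) (map (g′ *ₚ_) hs′)
    divides-all [] = []
    divides-all (_∷_ {h} e es) = divides h e ∷ divides-all es

  factorization-unique : ∀ {g g′ hs hs′} → Nonzero g → Reduced hs → Reduced hs′ →
    Pointwise (λ h h′ → g *ₚ h ≋ g′ *ₚ h′) hs hs′ → g ≋ g′ × Pointwise _≋_ hs hs′
  factorization-unique {g} {g′} {hs} {hs′} g≢0 (fnm , cop) (fnm′ , cop′) ps = g≋g′ , hs≋hs′
    where
    g∣g′ : g ∣ g′
    g∣g′ = Coprime⇒∣ cop′ ps
    g′∣g : g′ ∣ g
    g′∣g = Coprime⇒∣ {g′} {g} cop (Pointwise.symmetric ≋-sym ps)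
    open _∣_ g∣g′ renaming (quotient to u; equation to gu≋g′)
    open _∣_ g′∣g renaming (quotient to v; equation to g′v≋g)
    uv≋1 : u *ₚ v ≋ 1ₚ
    uv≋1 = *ₚ-cancelˡ g≢0 (begin
      g *ₚ (u *ₚ v)   ≈⟨ ≋-sym (*ₚ-assoc g u v) ⟩
      g *ₚ u *ₚ v     ≈⟨ *ₚ-congˡ v gu≋g′ ⟩
      g′ *ₚ v         ≈⟨ g′v≋g ⟩
      g               ≈⟨ ≋-sym (*ₚ-identityʳ g) ⟩
      g *ₚ 1ₚ         ∎)
      where open ≋-Reasoning
    su≡1 : size u ≡ 1
    su≡1 = ∣1ₚ⇒size≡1 {u} (divides v uv≋1)
    a : F
    a = coeff u 0
    a≢0 : ¬ (a ≡ 0F)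
    a≢0 = size-leading u 0 su≡1
    u≋a : u ≋ constant a
    u≋a = size≡1⇒≋constant su≡1
    h≋a·h′ : ∀ {h h′} → g *ₚ h ≋ g′ *ₚ h′ → h ≋ scale a h′
    h≋a·h′ {h} {h′} gh≋g′h′ = *ₚ-cancelˡ g≢0 (begin
      g *ₚ h                      ≈⟨ gh≋g′h′ ⟩
      g′ *ₚ h′                    ≈⟨ *ₚ-congˡ h′ (≋-sym gu≋g′) ⟩
      (g *ₚ u) *ₚ h′              ≈⟨ *ₚ-assoc g u h′ ⟩
      g *ₚ (u *ₚ h′)              ≈⟨ *ₚ-congʳ g (≋-trans (*ₚ-congˡ h′ u≋a) (constant-*ₚ a h′)) ⟩
      g *ₚ scale a h′             ∎)
      where open ≋-Reasoning
    hs≋a·hs′ : Pointwise (λ h h′ → h ≋ scale a h′) hs hs′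
    hs≋a·hs′ = Pointwise.map h≋a·h′ ps
    a≡1 : a ≡ 1F
    a≡1 = FirstNonzeroIsMonic-scale⇒≡1 a≢0 hs≋a·hs′ fnm fnm′
    g≋g′ : g ≋ g′
    g≋g′ = ≋-trans (≋-sym (*ₚ-identityʳ g))
      (≋-trans (*ₚ-congʳ g (≋-sym (≋-trans u≋a (∷-cong a≡1 ≋-refl)))) gu≋g′)
    hs≋hs′ : Pointwise _≋_ hs hs′
    hs≋hs′ = Pointwise.map (λ h≋ah′ → ≋-trans h≋ah′ (≋-trans (scale-cong a≡1 ≋-refl) (scale-1 _))) hs≋a·hs′

  quotients : ∀ {g fs} → All (g ∣_) fs → ∃ λ hs → g *ₗ hs ≋ fs
  quotients [] = [] , []
  quotients (divides h gh≋f ∷ ds) with quotients ds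
  ... | hs , ps = h ∷ hs , gh≋f ∷ ps

  normalizeFirstNonzero : ∀ hs → ¬ All (_≋ []) hs →
    ∃ λ a → ¬ (a ≡ 0F) × FirstNonzeroIsMonic (map (scale a) hs)
  normalizeFirstNonzero [] ¬all≋0 = ⊥-elim (¬all≋0 [])
  normalizeFirstNonzero (h ∷ hs) ¬all≋0 with ≋[]? h
  ... | yes h≋0 with normalizeFirstNonzero hs (¬all≋0 ∘ (h≋0 ∷_))
  ...   | a , a≢0 , fnm = a , a≢0 , inj₁ (scale-cong refl h≋0 , fnm)
  normalizeFirstNonzero (h ∷ hs) ¬all≋0 | no h≢0 with Nonzero⇒size≡suc h≢0
  ...   | m , sh = b , b≢0 , inj₂ (m , trans (size-scale {b} {h} b≢0) sh , trans (coeff-scale b h m) (*-inverseˡ c c≢0))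
    where
    c = coeff h m
    c≢0 = size-leading h m sh
    b = inv c c≢0
    b≢0 = inv-nonzero c c≢0

  -- The gcd d of the fᵢ, rescaled so that the first nonzero cofactor becomes monic.
  factorization-exists : ∀ fs → ¬ All (_≋ []) fs →
    ∃ λ g → ∃ λ hs → Nonzero g × Reduced hs × g *ₗ hs ≋ fs
  factorization-exists fs ¬all≋0 = G , map (scale a) hs , G≢0 , (fnm , coprime) , G*a·hs≋fs ps
    where
    gcd = idealGcd fs
    d = proj₁ gcd
    d∈ideal = proj₁ (proj₂ gcd)
    d∣fs = proj₂ (proj₂ gcd)
    hs = proj₁ (quotients d∣fs)
    ps = proj₂ (quotients d∣fs)
    d≢0 : Nonzero d
    d≢0 d≋0 = ¬all≋0 (all≋0 ps)
      where
      all≋0 : ∀ {hs fs} → d *ₗ hs ≋ fs → All (_≋ []) fs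
      all≋0 [] = []
      all≋0 (_∷_ {h} dh≋f ps) = ≋-trans (≋-sym dh≋f) (*ₚ-zeroˡ h d≋0) ∷ all≋0 ps
    normalizer = normalizeFirstNonzero hs (¬all≋0 ∘ *ₗ-All≋[]⁺ {d} ps)
    a = proj₁ normalizer
    a≢0 = proj₁ (proj₂ normalizer)
    fnm = proj₂ (proj₂ normalizer)
    b = inv a a≢0
    G = scale b d
    G≢0 = scale-nonzero (inv-nonzero a a≢0) d≢0
    G*a·h≋d*h : ∀ h → G *ₚ scale a h ≋ d *ₚ h
    G*a·h≋d*h h = begin
      G *ₚ scale a h
        ≈⟨ *ₚ-cong (constant-*ₚ⁻ b d) (constant-*ₚ⁻ a h) ⟩
      (constant b *ₚ d) *ₚ (constant a *ₚ h)
        ≈⟨ interchange (constant b) d (constant a) h ⟩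
      (constant b *ₚ constant a) *ₚ (d *ₚ h)
        ≈⟨ *ₚ-congˡ (d *ₚ h) (≋-trans (constant-*ₚ b (constant a)) (∷-cong (*-inverseˡ a a≢0) ≋-refl)) ⟩
      1ₚ *ₚ (d *ₚ h)
        ≈⟨ *ₚ-identityˡ (d *ₚ h) ⟩
      d *ₚ h ∎
      where
      open ≋-Reasoning
      open PolySolver
      interchange : ∀ x y z w → (x *ₚ y) *ₚ (z *ₚ w) ≋ (x *ₚ z) *ₚ (y *ₚ w)
      interchange = solve 4 (λ x y z w → (x :* y) :* (z :* w) := (x :* z) :* (y :* w)) ≋-refl
    G*a·hs≋fs : ∀ {hs fs} → d *ₗ hs ≋ fs → G *ₗ map (scale a) hs ≋ fs
    G*a·hs≋fs [] = []
    G*a·hs≋fs (_∷_ {h} dh≋f ps) = ≋-trans (G*a·h≋d*h h) dh≋f ∷ G*a·hs≋fs ps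
    G*a≋d : G *ₚ constant a ≋ d
    G*a≋d = ≋-trans (*ₚ-congʳ G (∷-cong (sym (F.*-identityʳ a)) ≋-refl))
                    (≋-trans (G*a·h≋d*h 1ₚ) (*ₚ-identityʳ d))
    coprime : Coprime (map (scale a) hs)
    coprime e e∣a·hs =
      ∣-trans (∣-cancelˡ G≢0 (∣-respʳ-≋ (≋-sym G*a≋d) (All∣⇒∣InIdeal (Ge∣fs ps e∣a·hs) d∈ideal)))
              (size≡1⇒∣1ₚ (size-constant a≢0))
      where
      Ge∣fs : ∀ {hs fs} → d *ₗ hs ≋ fs → All (e ∣_) (map (scale a) hs) → All (G *ₚ e ∣_) fs
      Ge∣fs [] [] = []
      Ge∣fs (_∷_ {h} dh≋f ps) (divides k ek≋ah ∷ ds) =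
        divides k (≋-trans (*ₚ-assoc G e k) (≋-trans (*ₚ-congʳ G ek≋ah) (≋-trans (G*a·h≋d*h h) dh≋f)))
        ∷ Ge∣fs ps ds

  -- Enumerating tuples

  tailₚ : Pol → Pol
  tailₚ [] = []
  tailₚ (_ ∷ p) = p

  coeff-tailₚ : ∀ p k → coeff (tailₚ p) k ≡ coeff p (suc k)
  coeff-tailₚ [] k = refl
  coeff-tailₚ (a ∷ p) k = refl

  coeffVec : (n : ℕ) → Pol → Vec F n
  coeffVec zero p = []ᵥ
  coeffVec (suc n) p = coeff p 0 ∷ᵥ coeffVec n (tailₚ p)

  coeffVec-cong : ∀ n {p p′} → p ≋ p′ → coeffVec n p ≡ coeffVec n p′
  coeffVec-cong zero e = refl
  coeffVec-cong (suc n) {p} {p′} e = cong₂ _∷ᵥ_ (coeff-≡ e 0)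
    (coeffVec-cong n (mk≋ λ k → trans (coeff-tailₚ p k) (trans (coeff-≡ e (suc k)) (sym (coeff-tailₚ p′ k)))))

  coeffVec-toList : ∀ {n} (v : Vec F n) → coeffVec n (toList v) ≡ v
  coeffVec-toList []ᵥ = refl
  coeffVec-toList (a ∷ᵥ v) = cong (a ∷ᵥ_) (coeffVec-toList v)

  toList-coeffVec : ∀ n {p} → DegreeBelow n p → toList (coeffVec n p) ≋ p
  toList-coeffVec zero d = ≋-sym (DegreeBelow-0⇒≋[] d)
  toList-coeffVec (suc n) {p} d = mk≋ λ where
      zero → refl
      (suc k) → trans (coeff-≡ (toList-coeffVec n d′) k) (coeff-tailₚ p k)
    where
    d′ : DegreeBelow n (tailₚ p)
    d′ = degreeBelow λ k n≤k → trans (coeff-tailₚ p k) (vanishes d (suc k) (s≤s n≤k))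

  toList-injective : ∀ {n} {v w : Vec F n} → toList v ≋ toList w → v ≡ w
  toList-injective {n} {v} {w} e = trans (sym (coeffVec-toList v)) (trans (coeffVec-cong n e) (coeffVec-toList w))

  DegreeBelow-toList : ∀ {n} (v : Vec F n) → DegreeBelow n (toList v)
  DegreeBelow-toList []ᵥ = DegreeBelow-[]
  DegreeBelow-toList (a ∷ᵥ v) = DegreeBelow-∷ (DegreeBelow-toList v)

  polys : ∀ {n} (ts : Vec ℕ n) → Tuple ts → List Pol
  polys []ᵥ _ = []
  polys (t ∷ᵥ ts) (f , fs) = toList f ∷ polys ts fs

  DividesAll⇒All∣ : ∀ {g n} (ts : Vec ℕ n) x → DividesAll g ts x → All (g ∣_) (polys ts x)
  DividesAll⇒All∣ []ᵥ x _ = []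
  DividesAll⇒All∣ (t ∷ᵥ ts) (f , fs) (g∣f , g∣fs) = ∣ₚ⇒∣ g∣f ∷ DividesAll⇒All∣ ts fs g∣fs

  All∣⇒DividesAll : ∀ {g n} (ts : Vec ℕ n) x → All (g ∣_) (polys ts x) → DividesAll g ts x
  All∣⇒DividesAll []ᵥ x _ = tt
  All∣⇒DividesAll (t ∷ᵥ ts) (f , fs) (g∣f ∷ g∣fs) = ∣⇒∣ₚ g∣f , All∣⇒DividesAll ts fs g∣fs

  FirstNonzeroMonic⇒ : ∀ {n} (ts : Vec ℕ n) x → FirstNonzeroMonic ts x → FirstNonzeroIsMonic (polys ts x)
  FirstNonzeroMonic⇒ (t ∷ᵥ ts) (f , fs) (inj₁ (f≡0 , r)) = inj₁ (IsZero⇒≋[] f≡0 , FirstNonzeroMonic⇒ ts fs r)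
  FirstNonzeroMonic⇒ (t ∷ᵥ ts) (f , fs) (inj₂ m) = inj₂ (Monic⇒IsMonic m)

  ⇒FirstNonzeroMonic : ∀ {n} (ts : Vec ℕ n) x → FirstNonzeroIsMonic (polys ts x) → FirstNonzeroMonic ts x
  ⇒FirstNonzeroMonic (t ∷ᵥ ts) (f , fs) (inj₁ (f≋0 , r)) = inj₁ (≋[]⇒IsZero f≋0 , ⇒FirstNonzeroMonic ts fs r)
  ⇒FirstNonzeroMonic (t ∷ᵥ ts) (f , fs) (inj₂ m) = inj₂ (IsMonic⇒Monic m)

  ReducedForm⇒Reduced : ∀ {n} (ts : Vec ℕ n) x → ReducedForm ts x → Reduced (polys ts x)
  ReducedForm⇒Reduced ts x (fnm , gcd≡1) =
    FirstNonzeroMonic⇒ ts x fnm , λ g g∣x → ∣ₚ⇒∣ (gcd≡1 g (All∣⇒DividesAll ts x g∣x))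

  Reduced⇒ReducedForm : ∀ {n} (ts : Vec ℕ n) x → Reduced (polys ts x) → ReducedForm ts x
  Reduced⇒ReducedForm ts x (fnm , cop) =
    ⇒FirstNonzeroMonic ts x fnm , λ g g∣x → ∣⇒∣ₚ (cop g (DividesAll⇒All∣ ts x g∣x))

  elements : List F
  elements = map (Inverse.from enumeration) (allFin q)

  ∈-elements : ∀ x → x ∈ elements
  ∈-elements x = subst (_∈ elements) (Inverse.strictlyInverseʳ enumeration x)
    (∈-map⁺ (Inverse.from enumeration) (∈-allFin (Inverse.to enumeration x)))

  elements-unique : Unique elements
  elements-unique = Unique.map⁺ from-injective (Unique.allFin⁺ q)
    where
    from-injective : ∀ {i j} → Inverse.from enumeration i ≡ Inverse.from enumeration j → i ≡ j
    from-injective {i} {j} e = trans (sym (Inverse.strictlyInverseˡ enumeration i))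
      (trans (cong (Inverse.to enumeration) e) (Inverse.strictlyInverseˡ enumeration j))

  length-elements : length elements ≡ q
  length-elements = trans (length-map _ (allFin q)) (length-tabulate (λ i → i))

  vectors : (n : ℕ) → List (Vec F n)
  vectors zero = []ᵥ ∷ []
  vectors (suc n) = map (λ (a , v) → a ∷ᵥ v) (dependentProduct elements (λ _ → vectors n))

  ∈-vectors : ∀ {n} (v : Vec F n) → v ∈ vectors n
  ∈-vectors []ᵥ = here refl
  ∈-vectors {suc n} (a ∷ᵥ v) =
    ∈-map⁺ (λ (a , v) → a ∷ᵥ v) (∈-dependentProduct⁺ {xs = elements} (∈-elements a) (∈-vectors v))

  vectors-unique : ∀ n → Unique (vectors n)
  vectors-unique zero = [] ∷ []
  vectors-unique (suc n) =
    Unique.map⁺ (λ { {a , v} {b , w} refl → refl }) (Unique-dependentProduct⁺ elements-unique (λ _ → vectors-unique n))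

  length-vectors : ∀ n → length (vectors n) ≡ q ^ n
  length-vectors zero = refl
  length-vectors (suc n) = begin
    length (vectors (suc n))                                        ≡⟨ length-map _ (dependentProduct elements (λ _ → vectors n)) ⟩
    length (dependentProduct elements (λ _ → vectors n))            ≡⟨ length-dependentProduct elements (λ _ → vectors n) ⟩
    sum (map (λ _ → length (vectors n)) elements)                   ≡⟨ sum-map-const elements _ ⟩
    length elements * length (vectors n)                            ≡⟨ cong₂ _*_ length-elements (length-vectors n) ⟩
    q * q ^ n                                                       ∎
    where open ≡-Reasoning

  tuples : ∀ {n} (ts : Vec ℕ n) → List (Tuple ts)
  tuples []ᵥ = tt ∷ []
  tuples (t ∷ᵥ ts) = dependentProduct (vectors t) (λ _ → tuples ts)

  ∈-tuples : ∀ {n} (ts : Vec ℕ n) x → x ∈ tuples ts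
  ∈-tuples []ᵥ tt = here refl
  ∈-tuples (t ∷ᵥ ts) (f , fs) = ∈-dependentProduct⁺ {xs = vectors t} (∈-vectors f) (∈-tuples ts fs)

  tuples-unique : ∀ {n} (ts : Vec ℕ n) → Unique (tuples ts)
  tuples-unique []ᵥ = [] ∷ []
  tuples-unique (t ∷ᵥ ts) = Unique-dependentProduct⁺ (vectors-unique t) (λ _ → tuples-unique ts)

  length-tuples : ∀ {n} (ts : Vec ℕ n) → length (tuples ts) ≡ q ^ Vec.sum ts
  length-tuples []ᵥ = refl
  length-tuples (t ∷ᵥ ts) = begin
    length (dependentProduct (vectors t) (λ _ → tuples ts))   ≡⟨ length-dependentProduct (vectors t) (λ _ → tuples ts) ⟩
    sum (map (λ _ → length (tuples ts)) (vectors t))          ≡⟨ sum-map-const (vectors t) _ ⟩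
    length (vectors t) * length (tuples ts)                   ≡⟨ cong₂ _*_ (length-vectors t) (length-tuples ts) ⟩
    q ^ t * q ^ Vec.sum ts                                    ≡⟨ sym (ℕ.^-distribˡ-+-* q t (Vec.sum ts)) ⟩
    q ^ (t + Vec.sum ts)                                      ∎
    where open ≡-Reasoning

  reducedTuples : ∀ {n} (ts : Vec ℕ n) → List (Tuple ts)
  reducedTuples ts = filter (reduced? ∘ polys ts) (tuples ts)

  reducedTuples-unique : ∀ {n} (ts : Vec ℕ n) → Unique (reducedTuples ts)
  reducedTuples-unique ts = Unique.filter⁺ (reduced? ∘ polys ts) (tuples-unique ts)

  ∈-reducedTuples⁺ : ∀ {n} (ts : Vec ℕ n) x → Reduced (polys ts x) → x ∈ reducedTuples ts
  ∈-reducedTuples⁺ ts x r = ∈-filter⁺ (reduced? ∘ polys ts) (∈-tuples ts x) r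

  ∈-reducedTuples⁻ : ∀ {n} (ts : Vec ℕ n) x → x ∈ reducedTuples ts → Reduced (polys ts x)
  ∈-reducedTuples⁻ ts x m = proj₂ (∈-filter⁻ (reduced? ∘ polys ts) {xs = tuples ts} m)

  nonzeroElements : List F
  nonzeroElements = filter (λ a → ¬? (a ≟F 0F)) elements

  ∈-nonzeroElements⁺ : ∀ {a} → ¬ (a ≡ 0F) → a ∈ nonzeroElements
  ∈-nonzeroElements⁺ {a} a≢0 = ∈-filter⁺ (λ a → ¬? (a ≟F 0F)) (∈-elements a) a≢0

  ∈-nonzeroElements⁻ : ∀ {a} → a ∈ nonzeroElements → ¬ (a ≡ 0F)
  ∈-nonzeroElements⁻ m = proj₂ (∈-filter⁻ (λ a → ¬? (a ≟F 0F)) {xs = elements} m)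

  nonzeroElements-unique : Unique nonzeroElements
  nonzeroElements-unique = Unique.filter⁺ (λ a → ¬? (a ≟F 0F)) elements-unique

  suc-length-nonzeroElements : suc (length nonzeroElements) ≡ q
  suc-length-nonzeroElements = trans (length-unique unique₀ elements-unique (λ {a} _ → ∈-elements a) split) length-elements
    where
    unique₀ : Unique (0F ∷ nonzeroElements)
    unique₀ = All.tabulate (λ m 0≡a → ∈-nonzeroElements⁻ m (sym 0≡a)) ∷ nonzeroElements-unique
    split : ∀ {a} → a ∈ elements → a ∈ 0F ∷ nonzeroElements
    split {a} _ with a ≟F 0F
    ... | yes refl = here refl
    ... | no a≢0 = there (∈-nonzeroElements⁺ a≢0)

  -- Counting nonzero tuples by their factorization

  withLeading : ∀ {e} → Vec F e → F → Pol
  withLeading low c = toList low ++ c ∷ []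

  DegreeBelow-withLeading : ∀ {e} (low : Vec F e) c → DegreeBelow (suc e) (withLeading low c)
  DegreeBelow-withLeading []ᵥ c = DegreeBelow-∷ DegreeBelow-[]
  DegreeBelow-withLeading (a ∷ᵥ low) c = DegreeBelow-∷ (DegreeBelow-withLeading low c)

  coeff-withLeading : ∀ {e} (low : Vec F e) c → coeff (withLeading low c) e ≡ c
  coeff-withLeading []ᵥ c = refl
  coeff-withLeading (a ∷ᵥ low) c = coeff-withLeading low c

  withLeading-nonzero : ∀ {e} (low : Vec F e) {c} → ¬ (c ≡ 0F) → Nonzero (withLeading low c)
  withLeading-nonzero {e} low {c} c≢0 g≋0 = c≢0 (trans (sym (coeff-withLeading low c)) (coeff-≡ g≋0 e))

  size-withLeading : ∀ {e} (low : Vec F e) {c} → ¬ (c ≡ 0F) → size (withLeading low c) ≡ suc e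
  size-withLeading low {c} c≢0 =
    size-exact (DegreeBelow-withLeading low c) (λ c′≡0 → c≢0 (trans (sym (coeff-withLeading low c)) c′≡0))

  withLeading-injective : ∀ {e} (low low′ : Vec F e) c c′ →
    withLeading low c ≋ withLeading low′ c′ → low ≡ low′ × c ≡ c′
  withLeading-injective []ᵥ []ᵥ c c′ e = refl , ≋-head e
  withLeading-injective (a ∷ᵥ low) (a′ ∷ᵥ low′) c c′ e with withLeading-injective low low′ c c′ (≋-tail e)
  ... | refl , refl = cong (_∷ᵥ low) (≋-head e) , refl

  withLeading-coeffVec : ∀ e {g c} → DegreeBelow (suc e) g → coeff g e ≡ c → withLeading (coeffVec e g) c ≋ g
  withLeading-coeffVec zero {g} d g₀≡c = mk≋ λ where
    zero → sym g₀≡c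
    (suc k) → sym (vanishes d (suc k) (s≤s z≤n))
  withLeading-coeffVec (suc e) {g} d gₑ≡c = mk≋ λ where
      zero → refl
      (suc k) → trans (coeff-≡ (withLeading-coeffVec e d′ (trans (coeff-tailₚ g e) gₑ≡c)) k) (coeff-tailₚ g k)
    where
    d′ : DegreeBelow (suc e) (tailₚ g)
    d′ = degreeBelow λ k e<k → trans (coeff-tailₚ g k) (vanishes d (suc k) (s≤s e<k))

  infixl 6 _∸ᵥ_
  _∸ᵥ_ : ∀ {n} → Vec ℕ n → ℕ → Vec ℕ n
  ts ∸ᵥ e = Vec.map (_∸ e) ts

  DegreeBelow-*ₚ-toList : ∀ e t {g} → DegreeBelow (suc e) g → (h : Vec F (t ∸ e)) → DegreeBelow t (g *ₚ toList h)
  DegreeBelow-*ₚ-toList e t {g} dg h with t ∸ e in t∸e≡ | h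
  ... | zero | []ᵥ = DegreeBelow-resp-≋ (≋-sym (*ₚ-zeroʳ g)) DegreeBelow-[]
  ... | suc j | h′ =
    subst (λ k → DegreeBelow k (g *ₚ toList h′)) 1+e+j≡t (DegreeBelow-*ₚ e j dg (DegreeBelow-toList h′))
    where
    e≤t : e ≤ t
    e≤t with e ℕ.≤? t
    ... | yes e≤t = e≤t
    ... | no e≰t with trans (sym t∸e≡) (ℕ.m≤n⇒m∸n≡0 (ℕ.<⇒≤ (ℕ.≰⇒> e≰t)))
    ...   | ()
    1+e+j≡t : suc (e + j) ≡ t
    1+e+j≡t = trans (sym (ℕ.+-suc e j)) (trans (cong (e +_) (sym t∸e≡)) (ℕ.m+[n∸m]≡n e≤t))

  DegreeBelow-cofactor : ∀ {g e h f t} → size g ≡ suc e → g *ₚ h ≋ f → DegreeBelow t f → DegreeBelow (t ∸ e) h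
  DegreeBelow-cofactor {g} {e} {h} {f} {t} sg gh≋f df with ≋[]? h
  ... | yes h≋0 = DegreeBelow-resp-≋ (≋-sym h≋0) DegreeBelow-[]
  ... | no h≢0 with Nonzero⇒size≡suc h≢0
  ...   | j , sh = size≤⇒DegreeBelow (begin
    size h               ≡⟨ sh ⟩
    suc j                ≡⟨ sym (ℕ.m+n∸m≡n e (suc j)) ⟩
    e + suc j ∸ e        ≡⟨ cong (_∸ e) (ℕ.+-suc e j) ⟩
    suc (e + j) ∸ e      ≡⟨ cong (_∸ e) (sym (trans (sym (size-cong gh≋f)) (size-*ₚ {g} {h} sg sh))) ⟩
    size f ∸ e           ≤⟨ ℕ.∸-monoˡ-≤ e (DegreeBelow⇒size≤ df) ⟩
    t ∸ e                ∎)
    where open ℕ.≤-Reasoning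

  size≤-common-factor : ∀ {g K hs fs} → g *ₗ hs ≋ fs → All (DegreeBelow K) fs → ¬ All (_≋ []) fs → size g ≤ K
  size≤-common-factor [] [] ¬all≋0 = ⊥-elim (¬all≋0 [])
  size≤-common-factor {g} (_∷_ {h} {f} gh≋f ps) (df ∷ dfs) ¬all≋0 with ≋[]? f
  ... | yes f≋0 = size≤-common-factor {g} ps dfs (¬all≋0 ∘ (f≋0 ∷_))
  ... | no f≢0 = ℕ.≤-trans (∣⇒size≤ {g} (divides h gh≋f) f≢0) (DegreeBelow⇒size≤ df)

  multiplyTuple : ∀ {n} (ts : Vec ℕ n) e (g : Pol) → Tuple (ts ∸ᵥ e) → Tuple ts
  multiplyTuple []ᵥ e g _ = tt
  multiplyTuple (t ∷ᵥ ts) e g (h , hs) = coeffVec t (g *ₚ toList h) , multiplyTuple ts e g hs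

  polys-multiplyTuple : ∀ {n} (ts : Vec ℕ n) e {g} → DegreeBelow (suc e) g → (hs : Tuple (ts ∸ᵥ e)) →
    g *ₗ polys (ts ∸ᵥ e) hs ≋ polys ts (multiplyTuple ts e g hs)
  polys-multiplyTuple []ᵥ e dg hs = []
  polys-multiplyTuple (t ∷ᵥ ts) e dg (h , hs) =
    ≋-sym (toList-coeffVec t (DegreeBelow-*ₚ-toList e t dg h)) ∷ polys-multiplyTuple ts e dg hs

  cofactorTuple : ∀ {n} (ts : Vec ℕ n) e → List Pol → Tuple (ts ∸ᵥ e)
  cofactorTuple []ᵥ e _ = tt
  cofactorTuple (t ∷ᵥ ts) e [] = coeffVec (t ∸ e) [] , cofactorTuple ts e []
  cofactorTuple (t ∷ᵥ ts) e (h ∷ hs) = coeffVec (t ∸ e) h , cofactorTuple ts e hs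

  cofactorTuple-correct : ∀ {n} (ts : Vec ℕ n) {g g′ e} → size g ≡ suc e → g′ ≋ g → DegreeBelow (suc e) g′ →
    ∀ x hs → g *ₗ hs ≋ polys ts x →
    Pointwise _≋_ hs (polys (ts ∸ᵥ e) (cofactorTuple ts e hs)) × multiplyTuple ts e g′ (cofactorTuple ts e hs) ≡ x
  cofactorTuple-correct []ᵥ sg g′≋g dg′ tt [] [] = [] , refl
  cofactorTuple-correct (t ∷ᵥ ts) {g} {g′} {e} sg g′≋g dg′ (f , fs) (h ∷ hs) (gh≋f ∷ ps)
    with cofactorTuple-correct ts sg g′≋g dg′ fs hs ps
  ... | hs≋ , fs≡ = ≋-sym h′≋h ∷ hs≋ , cong₂ _,_ f′≡f fs≡
    where
    h′≋h : toList (coeffVec (t ∸ e) h) ≋ h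
    h′≋h = toList-coeffVec (t ∸ e) (DegreeBelow-cofactor {g} sg gh≋f (DegreeBelow-toList f))
    f′≡f : coeffVec t (g′ *ₚ toList (coeffVec (t ∸ e) h)) ≡ f
    f′≡f = trans (coeffVec-cong t (≋-trans (*ₚ-cong g′≋g h′≋h) gh≋f)) (coeffVec-toList f)

  polys-injective : ∀ {n} (ts : Vec ℕ n) (x y : Tuple ts) → Pointwise _≋_ (polys ts x) (polys ts y) → x ≡ y
  polys-injective []ᵥ tt tt _ = refl
  polys-injective (t ∷ᵥ ts) (f , fs) (f′ , fs′) (f≋f′ ∷ ps) =
    cong₂ _,_ (toList-injective f≋f′) (polys-injective ts fs fs′ ps)

  DegreeBelow-polys : ∀ {n} (ts : Vec ℕ n) x → All (DegreeBelow (Vec.sum ts)) (polys ts x)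
  DegreeBelow-polys []ᵥ x = []
  DegreeBelow-polys (t ∷ᵥ ts) (f , fs) =
    DegreeBelow-mono (ℕ.m≤m+n t (Vec.sum ts)) (DegreeBelow-toList f)
    ∷ All.map (DegreeBelow-mono (ℕ.m≤n+m (Vec.sum ts) t)) (DegreeBelow-polys ts fs)

  Reduced-resp-≋ : ∀ {xs ys} → Pointwise _≋_ xs ys → Reduced xs → Reduced ys
  Reduced-resp-≋ {xs} {ys} ps (fnm , cop) = first ps fnm , λ d d∣ys → cop d (back ps d∣ys)
    where
    first : ∀ {xs ys} → Pointwise _≋_ xs ys → FirstNonzeroIsMonic xs → FirstNonzeroIsMonic ys
    first (e ∷ es) (inj₁ (x≋0 , r)) = inj₁ (≋-trans (≋-sym e) x≋0 , first es r)
    first (e ∷ es) (inj₂ m) = inj₂ (IsMonic-resp-≋ e m)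
    back : ∀ {d xs ys} → Pointwise _≋_ xs ys → All (d ∣_) ys → All (d ∣_) xs
    back [] [] = []
    back (e ∷ es) (d∣y ∷ ds) = ∣-respʳ-≋ (≋-sym e) d∣y ∷ back es ds

  FirstNonzeroIsMonic⇒¬All≋[] : ∀ {hs} → FirstNonzeroIsMonic hs → ¬ All (_≋ []) hs
  FirstNonzeroIsMonic⇒¬All≋[] {h ∷ hs} (inj₁ (_ , r)) (_ ∷ hs≋0) = FirstNonzeroIsMonic⇒¬All≋[] r hs≋0
  FirstNonzeroIsMonic⇒¬All≋[] {h ∷ hs} (inj₂ m) (h≋0 ∷ _) = IsMonic⇒Nonzero m h≋0

  toList-replicate-0F : ∀ t → toList (Vec.replicate t 0F) ≋ []
  toList-replicate-0F zero = ≋-refl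
  toList-replicate-0F (suc t) = mk≋ λ { zero → refl ; (suc k) → coeff-≡ (toList-replicate-0F t) k }

  zeroTuple : ∀ {n} (ts : Vec ℕ n) → Tuple ts
  zeroTuple []ᵥ = tt
  zeroTuple (t ∷ᵥ ts) = Vec.replicate t 0F , zeroTuple ts

  polys-zeroTuple : ∀ {n} (ts : Vec ℕ n) → All (_≋ []) (polys ts (zeroTuple ts))
  polys-zeroTuple []ᵥ = []
  polys-zeroTuple (t ∷ᵥ ts) = toList-replicate-0F t ∷ polys-zeroTuple ts

  All≋[]⇒≡zeroTuple : ∀ {n} (ts : Vec ℕ n) x → All (_≋ []) (polys ts x) → x ≡ zeroTuple ts
  All≋[]⇒≡zeroTuple []ᵥ tt [] = refl
  All≋[]⇒≡zeroTuple (t ∷ᵥ ts) (f , fs) (f≋0 ∷ fs≋0) =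
    cong₂ _,_ (toList-injective (≋-trans f≋0 (≋-sym (toList-replicate-0F t)))) (All≋[]⇒≡zeroTuple ts fs fs≋0)

  -- The factor g of g·(hᵢ), recorded by its degree e, its lower coefficients and its leading one.
  Factorization : ∀ {n} → Vec ℕ n → Set
  Factorization ts = Σ ℕ λ e → Vec F e × F × Tuple (ts ∸ᵥ e)

  module Counting {n} (ts : Vec ℕ n) where

    multiply : Factorization ts → Tuple ts
    multiply (e , low , c , hs) = multiplyTuple ts e (withLeading low c) hs

    polys-multiply : ∀ e low c hs → withLeading low c *ₗ polys (ts ∸ᵥ e) hs ≋ polys ts (multiply (e , low , c , hs))
    polys-multiply e low c hs = polys-multiplyTuple ts e (DegreeBelow-withLeading low c) hs

    factorizations : ℕ → List (Factorization ts)
    factorizations B = dependentProduct (upTo B) λ e →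
      dependentProduct (vectors e) λ _ → dependentProduct nonzeroElements λ _ → reducedTuples (ts ∸ᵥ e)

    ∈-factorizations⁻ : ∀ {B e low c hs} → (e , low , c , hs) ∈ factorizations B →
      e < B × ¬ (c ≡ 0F) × Reduced (polys (ts ∸ᵥ e) hs)
    ∈-factorizations⁻ {B} {e} {low} {c} {hs} m
      with ∈-dependentProduct⁻ {xs = upTo B} m
    ... | e∈ , m₁ with ∈-dependentProduct⁻ {xs = vectors e} m₁
    ...   | _ , m₂ with ∈-dependentProduct⁻ {xs = nonzeroElements} m₂
    ...     | c∈ , hs∈ = ∈-upTo⁻ e∈ , ∈-nonzeroElements⁻ c∈ , ∈-reducedTuples⁻ (ts ∸ᵥ e) hs hs∈

    ∈-factorizations⁺ : ∀ {B e low c hs} → e < B → ¬ (c ≡ 0F) → Reduced (polys (ts ∸ᵥ e) hs) →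
      (e , low , c , hs) ∈ factorizations B
    ∈-factorizations⁺ {B} {e} {low} {c} {hs} e<B c≢0 r =
      ∈-dependentProduct⁺ {xs = upTo B} (∈-upTo⁺ e<B)
        (∈-dependentProduct⁺ {xs = vectors e} (∈-vectors low)
          (∈-dependentProduct⁺ {xs = nonzeroElements} (∈-nonzeroElements⁺ c≢0) (∈-reducedTuples⁺ (ts ∸ᵥ e) hs r)))

    factorizations-unique : ∀ B → Unique (factorizations B)
    factorizations-unique B = Unique-dependentProduct⁺ (Unique.upTo⁺ B) λ e →
      Unique-dependentProduct⁺ (vectors-unique e) λ _ →
      Unique-dependentProduct⁺ nonzeroElements-unique λ _ → reducedTuples-unique (ts ∸ᵥ e)

    Factorization-≡ : ∀ {e e′ low low′ c c′} {hs : Tuple (ts ∸ᵥ e)} {hs′ : Tuple (ts ∸ᵥ e′)} →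
      ¬ (c ≡ 0F) → ¬ (c′ ≡ 0F) → withLeading low c ≋ withLeading low′ c′ →
      Pointwise _≋_ (polys (ts ∸ᵥ e) hs) (polys (ts ∸ᵥ e′) hs′) → (e , low , c , hs) ≡ (e′ , low′ , c′ , hs′)
    Factorization-≡ {e} {e′} {low} {low′} {c} {c′} {hs} {hs′} c≢0 c′≢0 g≋g′ hs≋hs′ with e≡e′
      where
      e≡e′ : e ≡ e′
      e≡e′ = ℕ.suc-injective
        (trans (sym (size-withLeading low c≢0)) (trans (size-cong g≋g′) (size-withLeading low′ c′≢0)))
    ... | refl with withLeading-injective low low′ c c′ g≋g′
    ...   | refl , refl = cong (λ hs → e , low , c , hs) (polys-injective (ts ∸ᵥ e) hs hs′ hs≋hs′)

    multiply-injective : ∀ {B} {s s′ : Factorization ts} → s ∈ factorizations B → s′ ∈ factorizations B →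
      multiply s ≡ multiply s′ → s ≡ s′
    multiply-injective {B} {e , low , c , hs} {e′ , low′ , c′ , hs′} m m′ same =
      Factorization-≡ c≢0 c′≢0 (proj₁ unique) (proj₂ unique)
      where
      facts = ∈-factorizations⁻ {B} {e} {low} {c} {hs} m
      facts′ = ∈-factorizations⁻ {B} {e′} {low′} {c′} {hs′} m′
      c≢0 = proj₁ (proj₂ facts)
      c′≢0 = proj₁ (proj₂ facts′)
      g = withLeading low c
      g′ = withLeading low′ c′
      gh≋g′h′ : Pointwise (λ h h′ → g *ₚ h ≋ g′ *ₚ h′) (polys (ts ∸ᵥ e) hs) (polys (ts ∸ᵥ e′) hs′)
      gh≋g′h′ = Pointwise.transitive ≋-trans (polys-multiply e low c hs)
        (Pointwise.symmetric ≋-sym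
          (subst (λ x → g′ *ₗ polys (ts ∸ᵥ e′) hs′ ≋ polys ts x) (sym same) (polys-multiply e′ low′ c′ hs′)))
      unique : g ≋ g′ × Pointwise _≋_ (polys (ts ∸ᵥ e) hs) (polys (ts ∸ᵥ e′) hs′)
      unique = factorization-unique (withLeading-nonzero low c≢0)
        (proj₂ (proj₂ facts)) (proj₂ (proj₂ facts′)) gh≋g′h′

    multiply-nonzero : ∀ {B} {s : Factorization ts} → s ∈ factorizations B → ¬ All (_≋ []) (polys ts (multiply s))
    multiply-nonzero {B} {e , low , c , hs} m all≋0 with ∈-factorizations⁻ {B} {e} {low} {c} {hs} m
    ... | _ , c≢0 , (fnm , _) =
      FirstNonzeroIsMonic⇒¬All≋[] fnm (*ₗ-All≋[]⁻ (withLeading-nonzero low c≢0) (polys-multiply e low c hs) all≋0)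

    multiply-surjective : ∀ B → Vec.sum ts ≤ B → ∀ x → ¬ All (_≋ []) (polys ts x) →
      ∃ λ s → s ∈ factorizations B × multiply s ≡ x
    multiply-surjective B sum≤B x ¬all≋0 =
      (e , coeffVec e g , coeff g e , cofactorTuple ts e hs) ,
      ∈-factorizations⁺ e<B (size-leading g e sg) (Reduced-resp-≋ (proj₁ cofactors) r) , proj₂ cofactors
      where
      factored = factorization-exists (polys ts x) ¬all≋0
      g = proj₁ factored
      hs = proj₁ (proj₂ factored)
      g≢0 = proj₁ (proj₂ (proj₂ factored))
      r = proj₁ (proj₂ (proj₂ (proj₂ factored)))
      ps = proj₂ (proj₂ (proj₂ (proj₂ factored)))
      e = proj₁ (Nonzero⇒size≡suc g≢0)
      sg : size g ≡ suc e
      sg = proj₂ (Nonzero⇒size≡suc g≢0)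
      g′≋g : withLeading (coeffVec e g) (coeff g e) ≋ g
      g′≋g = withLeading-coeffVec e (size≡⇒DegreeBelow g sg) refl
      cofactors : Pointwise _≋_ hs (polys (ts ∸ᵥ e) (cofactorTuple ts e hs)) ×
                  multiply (e , coeffVec e g , coeff g e , cofactorTuple ts e hs) ≡ x
      cofactors = cofactorTuple-correct ts sg g′≋g (DegreeBelow-withLeading (coeffVec e g) (coeff g e)) x hs ps
      e<B : e < B
      e<B = ℕ.≤-trans (subst (_≤ Vec.sum ts) sg (size≤-common-factor {g} ps (DegreeBelow-polys ts x) ¬all≋0)) sum≤B

    nonzero-tuples : ∀ B → Vec.sum ts ≤ B → ∀ x → x ∈ zeroTuple ts ∷ map multiply (factorizations B)
    nonzero-tuples B sum≤B x = cover (All.all? ≋[]? (polys ts x))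
      where
      cover : Dec (All (_≋ []) (polys ts x)) → x ∈ zeroTuple ts ∷ map multiply (factorizations B)
      cover (yes all≋0) = here (All≋[]⇒≡zeroTuple ts x all≋0)
      cover (no ¬all≋0) = let s , s∈ , s↦x = multiply-surjective B sum≤B x ¬all≋0 in
        there (subst (_∈ map multiply (factorizations B)) s↦x (∈-map⁺ multiply s∈))

    zeroTuple∉image : ∀ B {y} → y ∈ map multiply (factorizations B) → ¬ (zeroTuple ts ≡ y)
    zeroTuple∉image B y∈ 0≡y = let s , s∈ , y≡ = ∈-map⁻ multiply y∈ in
      multiply-nonzero {B} s∈ (subst (λ z → All (_≋ []) (polys ts z)) (trans 0≡y y≡) (polys-zeroTuple ts))

    power-count : ∀ B → Vec.sum ts ≤ B → q ^ Vec.sum ts ≡ suc (length (factorizations B))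
    power-count B sum≤B = begin
      q ^ Vec.sum ts
        ≡⟨ sym (length-tuples ts) ⟩
      length (tuples ts)
        ≡⟨ length-unique (tuples-unique ts) unique (λ {x} _ → nonzero-tuples B sum≤B x) (λ {x} _ → ∈-tuples ts x) ⟩
      length (zeroTuple ts ∷ map multiply (factorizations B))
        ≡⟨ cong suc (length-map multiply (factorizations B)) ⟩
      suc (length (factorizations B)) ∎
      where
      open ≡-Reasoning
      unique : Unique (zeroTuple ts ∷ map multiply (factorizations B))
      unique = All.tabulate (zeroTuple∉image B) ∷ Unique-map⁺ multiply (multiply-injective {B}) (factorizations-unique B)

    length-factorizations : ∀ B → length (factorizations B) ≡
      sum (map (λ e → q ^ e * (length nonzeroElements * length (reducedTuples (ts ∸ᵥ e)))) (upTo B))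
    length-factorizations B =
      trans (length-dependentProduct (upTo B) _) (cong sum (map-cong count-per-degree (upTo B)))
      where
      count-per-degree : ∀ e →
        length (dependentProduct (vectors e) λ _ → dependentProduct nonzeroElements λ _ → reducedTuples (ts ∸ᵥ e))
        ≡ q ^ e * (length nonzeroElements * length (reducedTuples (ts ∸ᵥ e)))
      count-per-degree e =
        trans (length-dependentProduct (vectors e) _) (trans (sum-map-const (vectors e) _) (cong₂ _*_ (length-vectors e)
          (trans (length-dependentProduct nonzeroElements _) (sum-map-const nonzeroElements _))))

  ∸ᵥ-suc : ∀ {n} (ts : Vec ℕ n) e → ts ∸ᵥ suc e ≡ ts ∸ᵥ 1 ∸ᵥ e
  ∸ᵥ-suc []ᵥ e = refl
  ∸ᵥ-suc (t ∷ᵥ ts) e = cong₂ _∷ᵥ_ (sym (ℕ.∸-+-assoc t 1 e)) (∸ᵥ-suc ts e)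

  ∸ᵥ-zero : ∀ {n} (ts : Vec ℕ n) → ts ∸ᵥ 0 ≡ ts
  ∸ᵥ-zero []ᵥ = refl
  ∸ᵥ-zero (t ∷ᵥ ts) = cong (t ∷ᵥ_) (∸ᵥ-zero ts)

  sum-∸ᵥ-1 : ∀ {n} (ts : Vec ℕ n) → Allᵥ (1 ≤_) ts → Vec.sum ts ≡ Vec.sum (ts ∸ᵥ 1) + n
  sum-∸ᵥ-1 []ᵥ [] = refl
  sum-∸ᵥ-1 {suc n} (suc t ∷ᵥ ts) (_ ∷ 1≤ts) = begin
    suc t + Vec.sum ts                    ≡⟨ cong (suc t +_) (sum-∸ᵥ-1 ts 1≤ts) ⟩
    suc t + (Vec.sum (ts ∸ᵥ 1) + n)       ≡⟨ cong suc (sym (ℕ.+-assoc t _ n)) ⟩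
    suc (t + Vec.sum (ts ∸ᵥ 1) + n)       ≡⟨ sym (ℕ.+-suc _ n) ⟩
    t + Vec.sum (ts ∸ᵥ 1) + suc n         ∎
    where open ≡-Reasoning

  length-reducedTuples : ∀ l (ts : Vec ℕ (suc l)) → Allᵥ (1 ≤_) ts →
    length (reducedTuples ts) ≡ expectedCount q l (Vec.sum ts)
  length-reducedTuples l ts 1≤ts =
    sym (trans (cong (expectedCount q l) sum≡) (expectedCount-from-recurrence d l K r a (sym suc-length-nonzeroElements) big small))
    where
    d = length nonzeroElements
    instance
      d≢0 : NonZero d
      d≢0 = >-nonZero (∈-length (∈-nonzeroElements⁺ 1≢0))
    R : ∀ {n} → Vec ℕ n → ℕ
    R ss = length (reducedTuples ss)
    r = R ts
    ts₁ = ts ∸ᵥ 1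
    K = Vec.sum ts₁
    sum≡ : Vec.sum ts ≡ K + suc l
    sum≡ = sum-∸ᵥ-1 ts 1≤ts
    f g : ℕ → ℕ
    f e = q ^ e * (d * R (ts ∸ᵥ e))
    g e = q ^ e * (d * R (ts₁ ∸ᵥ e))
    a = sum (map g (upTo (K + l)))
    f0≡dr : f 0 ≡ d * r
    f0≡dr = trans (ℕ.*-identityˡ _) (cong (λ ss → d * R ss) (∸ᵥ-zero ts))
    f∘suc≗q*g : ∀ e → f (suc e) ≡ q * g e
    f∘suc≗q*g e = trans (ℕ.*-assoc q (q ^ e) _) (cong (λ ss → q * (q ^ e * (d * R ss))) (∸ᵥ-suc ts e))
    small : q ^ K ≡ suc a
    small = trans (Counting.power-count ts₁ (K + l) (ℕ.m≤m+n K l)) (cong suc (Counting.length-factorizations ts₁ (K + l)))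
    big : q ^ (K + suc l) ≡ suc (d * r + q * a)
    big = begin
      q ^ (K + suc l)
        ≡⟨ cong (q ^_) (sym sum≡) ⟩
      q ^ Vec.sum ts
        ≡⟨ Counting.power-count ts (suc (K + l)) (ℕ.≤-reflexive (trans sum≡ (ℕ.+-suc K l))) ⟩
      suc (length (Counting.factorizations ts (suc (K + l))))
        ≡⟨ cong suc (Counting.length-factorizations ts (suc (K + l))) ⟩
      suc (sum (map f (upTo (suc (K + l)))))
        ≡⟨ cong suc (sum-upTo-suc f (K + l)) ⟩
      suc (f 0 + sum (map (f ∘ suc) (upTo (K + l))))
        ≡⟨ cong suc (cong₂ _+_ f0≡dr (cong sum (map-cong f∘suc≗q*g (upTo (K + l))))) ⟩
      suc (d * r + sum (map (λ e → q * g e) (upTo (K + l))))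
        ≡⟨ cong (λ x → suc (d * r + x)) (sum-map-*ˡ q g (upTo (K + l))) ⟩
      suc (d * r + q * a) ∎
      where open ≡-Reasoning

open import Data.Fin using (Fin)
import Data.Fin
open import Data.Vec using (Vec; lookup; sum)
open import Data.Vec.Relation.Unary.All using (All)

lemma2p16 : {q : ℕ} (𝔽 : FiniteField q) (l : ℕ) → 1 ≤ l →
    (t : Vec ℕ (suc l)) → All (1 ≤_) t →
    (∀ (i j : Fin (suc l)) → i Data.Fin.≤ j → lookup t i ≤ lookup t j) →
    ∃ λ (S : List (Poly.Tuple 𝔽 t)) →
      Unique S × (∀ x → (x ∈ S) ⇔ Poly.ReducedForm 𝔽 t x) ×
      length S ≡ expectedCount q l (sum t)
lemma2p16 𝔽 l _ t 1≤t _ =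
  reducedTuples t ,
  reducedTuples-unique t ,
  (λ x → mk⇔ (Reduced⇒ReducedForm t x ∘ ∈-reducedTuples⁻ t x) (∈-reducedTuples⁺ t x ∘ ReducedForm⇒Reduced t x)) ,
  length-reducedTuples l t 1≤t
  where open Polynomials 𝔽
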